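{- For integers $n\ge i\ge 0$, let $\beta_{n,i}$ be the total number of $\mathbf{v}$-steps at level $i$ in all G-Motzkin paths of length $n+1$, and let $\gamma_{n,i}$ be the total number of $\mathbf{d}$-steps at level $i$ in all G-Motzkin paths of length $n+2$. Then \[ \beta_{n,i}=\gamma_{n,i}=\sum_{j=i}^{n}B_{j,i}\sum_{k=0}^{j}\binom{j}{k}\binom{n+j+2-k}{n-j-k},\qquad B_{j,i}=\frac{2i+3}{2j+3}\binom{2j+3}{j-i}. \] Moreover, $\beta_{n,i}$ is the $(n,i)$-entry of the Riordan array \[ \Big(\frac{1}{(1-x)^3}C\Big(\frac{x(1+x)}{(1-x)^2}\Big)^3,\ \frac{x(1+x)}{(1-x)^2}C\Big(\frac{x(1+x)}{(1-x)^2}\Big)^2\Big), \] where $C(x)=\frac{1-\sqrt{1-4x}}{2x}$ is the Catalan generating function.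
   Context: A G-Motzkin path of length $n$ is a lattice path from $(0,0)$ to $(n,0)$ that never goes below the $x$-axis and consists of up steps $\mathbf{u}=(1,1)$, down steps $\mathbf{d}=(1,-1)$, horizontal steps $\mathbf{h}=(1,0)$ and vertical steps $\mathbf{v}=(0,-1)$. A step is at level $\ell$ if the ordinate of its endpoint is $\ell$. Binomial coefficients $\binom{a}{b}$ with $b<0$ are $0$. For formal power series $d(x),h(x)$ with $d(0)=1$, $h(0)=0$, the Riordan array $(d(x),h(x))$ is the infinite lower triangular matrix whose $(n,i)$-entry is $[x^n]\,d(x)h(x)^i$. -}

module Defs where

open import Data.Nat using (ℕ; zero; suc; _+_; _*_; _∸_; _/_; _<ᵇ_; _≡ᵇ_)
open import Data.Nat.Combinatorics using (_C_)
open import Data.Bool using (Bool; true; false; if_then_else_; _∧_)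
open import Data.Maybe using (Maybe; just; nothing)
open import Data.List using (List; []; _∷_; map; concatMap)
open import Data.Nat.ListAction using (sum)

-- u = (1,1), d = (1,-1), h = (1,0), v = (0,-1)
data Step : Set where
  U D H V : Step

steps : List Step
steps = U ∷ D ∷ H ∷ V ∷ []

hlen : List Step → ℕ
hlen []       = 0
hlen (V ∷ p)  = hlen p
hlen (_ ∷ p)  = suc (hlen p)

walk : ℕ → List Step → Maybe ℕ
walk y       []      = just y
walk y       (U ∷ p) = walk (suc y) p
walk y       (H ∷ p) = walk y p
walk zero    (D ∷ p) = nothing
walk (suc y) (D ∷ p) = walk y p
walk zero    (V ∷ p) = nothing
walk (suc y) (V ∷ p) = walk y p

isZero? : Maybe ℕ → Bool
isZero? (just zero) = true
isZero? _           = false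

isGMotzkin : ℕ → List Step → Bool
isGMotzkin n p = isZero? (walk 0 p) ∧ (hlen p ≡ᵇ n)

sameStep : Step → Step → Bool
sameStep U U = true
sameStep D D = true
sameStep H H = true
sameStep V V = true
sameStep _ _ = false

-- number of s-steps at level i (level = ordinate of the endpoint of the
-- step) in the step sequence p started at height y
countAt : Step → ℕ → ℕ → List Step → ℕ
countAt s i y []      = 0
countAt s i y (t ∷ p) =
  (if sameStep s t ∧ (y' ≡ᵇ i) then 1 else 0) + countAt s i y' p
  where
  y' : ℕ
  y' = height t
    where
    height : Step → ℕ
    height U = suc y
    height D = y ∸ 1
    height H = y
    height V = y ∸ 1

allLists : ℕ → List (List Step)
allLists zero    = [] ∷ []
allLists (suc k) = [] ∷ concatMap (λ s → map (s ∷_) (allLists k)) steps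

filterB : {A : Set} → (A → Bool) → List A → List A
filterB f []       = []
filterB f (x ∷ xs) = if f x then x ∷ filterB f xs else filterB f xs

-- all G-Motzkin paths of length n.  A G-Motzkin path of length n has
-- #u ≤ n and #v ≤ #u, hence at most 2n steps, so it suffices to search
-- among step sequences of length ≤ 2n.
gMotzkinPaths : ℕ → List (List Step)
gMotzkinPaths n = filterB (isGMotzkin n) (allLists (2 * n))

totalSteps : Step → ℕ → ℕ → ℕ
totalSteps s i n = sum (map (countAt s i 0) (gMotzkinPaths n))

β : ℕ → ℕ → ℕ
β n i = totalSteps V i (suc n)

γ : ℕ → ℕ → ℕ
γ n i = totalSteps D i (suc (suc n))

-- Σ_{k=a}^{b} f k  (empty, i.e. 0, when b < a)
sumFromTo : ℕ → ℕ → (ℕ → ℕ) → ℕ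
sumFromTo a zero    f = if a ≡ᵇ 0 then f 0 else 0
sumFromTo a (suc b) f = sumFromTo a b f + (if suc b <ᵇ a then 0 else f (suc b))

-- B_{j,i} = (2i+3)/(2j+3) * binom(2j+3, j-i)  (for j ≥ i; this is an integer,
-- so the natural-number division is exact)
B : ℕ → ℕ → ℕ
B j i = ((2 * i + 3) * ((2 * j + 3) C (j ∸ i))) / suc (suc (suc (2 * j)))

-- binom(n+j+2-k, n-j-k), which is 0 when n-j-k < 0 (used for k ≤ j)
innerBinom : ℕ → ℕ → ℕ → ℕ
innerBinom n j k = if n <ᵇ j + k then 0 else (n + j + 2 ∸ k) C (n ∸ (j + k))

formula : ℕ → ℕ → ℕ
formula n i =
  sumFromTo i n (λ j → B j i * sumFromTo 0 j (λ k → (j C k) * innerBinom n j k))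

Series : Set
Series = ℕ → ℕ

one : Series
one zero    = 1
one (suc _) = 0

X : Series
X (suc zero) = 1
X _          = 0

_⊕_ : Series → Series → Series
(f ⊕ g) n = f n + g n

_⊛_ : Series → Series → Series
(f ⊛ g) n = sumFromTo 0 n (λ k → f k * g (n ∸ k))

_^ˢ_ : Series → ℕ → Series
f ^ˢ zero  = one
f ^ˢ suc k = f ⊛ (f ^ˢ k)

-- composition f(g(x)), meaningful when g(0) = 0
_∘ˢ_ : Series → Series → Series
(f ∘ˢ g) n = sumFromTo 0 n (λ k → f k * (g ^ˢ k) n)

-- 1/(1-x) = Σ x^n
geom : Series
geom _ = 1

-- Catalan generating function C(x) = (1 - sqrt(1-4x))/(2x) = Σ Cat_n x^n,
-- Cat_n = binom(2n,n)/(n+1)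
catalanGF : Series
catalanGF n = ((2 * n) C n) / suc n

-- x(1+x)/(1-x)^2
hArg : Series
hArg = (X ⊛ (one ⊕ X)) ⊛ (geom ^ˢ 2)

riordanD : Series
riordanD = (geom ^ˢ 3) ⊛ ((catalanGF ∘ˢ hArg) ^ˢ 3)

riordanH : Series
riordanH = hArg ⊛ ((catalanGF ∘ˢ hArg) ^ˢ 2)

riordanEntry : Series → Series → ℕ → ℕ → ℕ
riordanEntry d h n i = (d ⊛ (h ^ˢ i)) n

module Submission where

-- The (n,i)-entry of the Riordan array is [x^n] E_i(x) K(x)^(2i+3), where K = C(h₀), h₀ = x(1+x)/(1-x)²
-- and E_i = h₀^i/(1-x)³. Expanding K^r = Σ_k b(r,k) h₀^k with the ballot numbers
-- b(r,k) = [t^k] C(t)^r = r/(2k+r)·binom(2k+r,k), and [x^n] E_j by the binomial series, gives the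
-- explicit double sum, with B_{j,i} = b(2i+3, j-i).
--
-- Let W y h count, by length, the paths with steps u, h, d, v from height y to height h that never go
-- below the axis. Splitting off the first step gives the linear system
--   W y h = [y = h] + x (W (y+1) h + W y h + W (y-1) h) + W (y-1) h,
-- solved by W y h = Σ_j G descent^(y-j) ascent^(h-j), where G = K/(1-x) counts G-Motzkin paths,
-- descent = (1+x) G and ascent = x G. Cutting a path at a v-step (a d-step) at level i shows that
-- β (γ) is a coefficient of W 0 (i+1) · W i 0 (of x W 0 (i+1) · W i 0), and W 0 (i+1) · W i 0 = x d(x) h(x)^i.
-- Being sums over all step sequences of bounded length, β and γ obey the same first-step recursion
-- and therefore agree with these coefficients.

open import Defs
open import Algebra.Bundles using (CommutativeSemiring)
import Algebra.Construct.Pointwise as Pointwise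
import Algebra.Properties.CommutativeSemiring.Exp as Exp
import Algebra.Solver.Ring.NaturalCoefficients.Default as NaturalSolver
open import Algebra.Structures.Biased using (IsCommutativeSemiringˡ)
open import Data.Bool using (Bool; true; false; if_then_else_; _∧_)
import Data.Bool as Bool
open import Data.Bool.Properties using (∧-zeroʳ)
open import Data.List using (List; []; _∷_; map; _++_)
open import Data.List.Properties using (map-++; map-∘)
open import Data.Nat
open import Data.Nat.Combinatorics using (_C_; nC1≡n; nCn≡1; nCk+nC[k+1]≡[n+1]C[k+1])
open import Data.Nat.DivMod using (m*n/n≡m)
open import Data.Nat.Induction using (<-rec)
open import Data.Nat.ListAction using (sum)
open import Data.Nat.ListAction.Properties using (sum-++)
open import Data.Nat.Properties
open import Data.Nat.Solver using (module +-*-Solver)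
open import Data.Product using (_×_; _,_)
open import Function using (_∘_)
open import Relation.Binary.PropositionalEquality
import Relation.Binary.Reasoning.Setoid as SetoidReasoning
open import Relation.Nullary using (contradiction)
open import Algebra.Properties.CommutativeSemigroup +-commutativeSemigroup using ()
  renaming (interchange to +-interchange)
open import Algebra.Properties.CommutativeSemigroup *-commutativeSemigroup using ()
  renaming (x∙yz≈y∙xz to *-left-comm)

<ᵇ-true : ∀ {m n} → m < n → (m <ᵇ n) ≡ true
<ᵇ-true {zero}  (s≤s _)   = refl
<ᵇ-true {suc m} (s≤s m<n) = <ᵇ-true m<n

<ᵇ-false : ∀ {m n} → n ≤ m → (m <ᵇ n) ≡ false
<ᵇ-false z≤n       = refl
<ᵇ-false (s≤s n≤m) = <ᵇ-false n≤m

sum-unconsˡ : ∀ n f → sumFromTo 0 (suc n) f ≡ f 0 + sumFromTo 0 n (f ∘ suc)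
sum-unconsˡ zero    f = refl
sum-unconsˡ (suc n) f = begin
  sumFromTo 0 (suc n) f + f (suc (suc n))          ≡⟨ cong (_+ f (suc (suc n))) (sum-unconsˡ n f) ⟩
  f 0 + sumFromTo 0 n (f ∘ suc) + f (suc (suc n))  ≡⟨ +-assoc (f 0) _ _ ⟩
  f 0 + sumFromTo 0 (suc n) (f ∘ suc)              ∎
  where open ≡-Reasoning

sum-cong : ∀ n {f g : ℕ → ℕ} → (∀ k → k ≤ n → f k ≡ g k) → sumFromTo 0 n f ≡ sumFromTo 0 n g
sum-cong zero    f≡g = f≡g 0 z≤n
sum-cong (suc n) f≡g =
  cong₂ _+_ (sum-cong n (λ k k≤n → f≡g k (m≤n⇒m≤1+n k≤n))) (f≡g (suc n) ≤-refl)

sum-zero : ∀ n {f} → (∀ k → k ≤ n → f k ≡ 0) → sumFromTo 0 n f ≡ 0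
sum-zero zero    f≡0 = f≡0 0 z≤n
sum-zero (suc n) f≡0 =
  cong₂ _+_ (sum-zero n (λ k k≤n → f≡0 k (m≤n⇒m≤1+n k≤n))) (f≡0 (suc n) ≤-refl)

sum-+ : ∀ n f g → sumFromTo 0 n (λ k → f k + g k) ≡ sumFromTo 0 n f + sumFromTo 0 n g
sum-+ zero    f g = refl
sum-+ (suc n) f g = trans (cong (_+ (f (suc n) + g (suc n))) (sum-+ n f g))
  (+-interchange (sumFromTo 0 n f) (sumFromTo 0 n g) (f (suc n)) (g (suc n)))

sum-*ˡ : ∀ n a f → sumFromTo 0 n (λ k → a * f k) ≡ a * sumFromTo 0 n f
sum-*ˡ zero    a f = refl
sum-*ˡ (suc n) a f = trans (cong (_+ a * f (suc n)) (sum-*ˡ n a f)) (sym (*-distribˡ-+ a _ _))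

sum-swap : ∀ m n (a : ℕ → ℕ → ℕ) →
  sumFromTo 0 m (λ j → sumFromTo 0 n (a j)) ≡ sumFromTo 0 n (λ k → sumFromTo 0 m (λ j → a j k))
sum-swap zero    n a = refl
sum-swap (suc m) n a = trans (cong (_+ sumFromTo 0 n (a (suc m))) (sum-swap m n a))
  (sym (sum-+ n (λ k → sumFromTo 0 m (λ j → a j k)) (a (suc m))))

sum-extend : ∀ {n N} f → n ≤ N → (∀ k → n < k → k ≤ N → f k ≡ 0) →
             sumFromTo 0 n f ≡ sumFromTo 0 N f
sum-extend f n≤N = go (≤⇒≤′ n≤N)
  where
  go : ∀ {n N} → n ≤′ N → (∀ k → n < k → k ≤ N → f k ≡ 0) → sumFromTo 0 n f ≡ sumFromTo 0 N f
  go ≤′-refl                    _   = refl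
  go {n} (≤′-step {N} n≤′N) f≡0 = begin
    sumFromTo 0 n f          ≡⟨ go n≤′N (λ k n<k k≤N → f≡0 k n<k (m≤n⇒m≤1+n k≤N)) ⟩
    sumFromTo 0 N f          ≡⟨ +-identityʳ _ ⟨
    sumFromTo 0 N f + 0      ≡⟨ cong (sumFromTo 0 N f +_) (f≡0 (suc N) (s≤s (≤′⇒≤ n≤′N)) ≤-refl) ⟨
    sumFromTo 0 (suc N) f    ∎
    where open ≡-Reasoning

sum-reverse : ∀ n f → sumFromTo 0 n f ≡ sumFromTo 0 n (λ k → f (n ∸ k))
sum-reverse zero    f = refl
sum-reverse (suc n) f = begin
  sumFromTo 0 (suc n) f                          ≡⟨ sum-unconsˡ n f ⟩
  f 0 + sumFromTo 0 n (f ∘ suc)                  ≡⟨ cong (f 0 +_) (sum-reverse n (f ∘ suc)) ⟩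
  f 0 + sumFromTo 0 n (λ k → f (suc (n ∸ k)))    ≡⟨ +-comm (f 0) _ ⟩
  sumFromTo 0 n (λ k → f (suc (n ∸ k))) + f 0    ≡⟨ cong₂ _+_ (sum-cong n (λ k k≤n → cong f (+-∸-assoc 1 k≤n)))
                                                              (cong f (n∸n≡0 n)) ⟨
  sumFromTo 0 (suc n) (λ k → f (suc n ∸ k))      ∎
  where open ≡-Reasoning

sumFromTo-empty : ∀ a b f → b < a → sumFromTo a b f ≡ 0
sumFromTo-empty (suc a) zero    f _    = refl
sumFromTo-empty a       (suc b) f b<a rewrite <ᵇ-true b<a =
  trans (+-identityʳ _) (sumFromTo-empty a b f (<-trans (n<1+n b) b<a))

sumFromTo-offset : ∀ i d f → sumFromTo i (i + d) f ≡ sumFromTo 0 d (λ k → f (i + k))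
sumFromTo-offset i zero f rewrite +-identityʳ i = single i
  where
  single : ∀ i → sumFromTo i i f ≡ f i
  single zero    = refl
  single (suc i) rewrite <ᵇ-false (≤-refl {suc i}) =
    cong (_+ f (suc i)) (sumFromTo-empty (suc i) i f ≤-refl)
sumFromTo-offset i (suc d) f rewrite +-suc i d | <ᵇ-false (m≤n⇒m≤1+n (m≤m+n i d)) =
  cong (_+ f (suc (i + d))) (sumFromTo-offset i d f)

module _ {A : Set} where

  sum-map-cong : ∀ {f g : A → ℕ} L → (∀ x → f x ≡ g x) → sum (map f L) ≡ sum (map g L)
  sum-map-cong []      f≡g = refl
  sum-map-cong (x ∷ L) f≡g = cong₂ _+_ (f≡g x) (sum-map-cong L f≡g)

  sum-map-zero : ∀ {f : A → ℕ} L → (∀ x → f x ≡ 0) → sum (map f L) ≡ 0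
  sum-map-zero []      f≡0 = refl
  sum-map-zero (x ∷ L) f≡0 = cong₂ _+_ (f≡0 x) (sum-map-zero L f≡0)

  sum-map-+ : ∀ (f g : A → ℕ) L → sum (map (λ x → f x + g x) L) ≡ sum (map f L) + sum (map g L)
  sum-map-+ f g []      = refl
  sum-map-+ f g (x ∷ L) = trans (cong (f x + g x +_) (sum-map-+ f g L))
    (+-interchange (f x) (g x) (sum (map f L)) (sum (map g L)))

  sum-map-*ˡ : ∀ a (f : A → ℕ) L → sum (map (λ x → a * f x) L) ≡ a * sum (map f L)
  sum-map-*ˡ a f []      = sym (*-zeroʳ a)
  sum-map-*ˡ a f (x ∷ L) = trans (cong (a * f x +_) (sum-map-*ˡ a f L)) (sym (*-distribˡ-+ a (f x) _))

  sum-map-++ : ∀ (f : A → ℕ) xs ys → sum (map f (xs ++ ys)) ≡ sum (map f xs) + sum (map f ys)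
  sum-map-++ f xs ys = trans (cong sum (map-++ f xs ys)) (sum-++ (map f xs) (map f ys))

  sum-filterB : ∀ (b : A → Bool) (f : A → ℕ) L →
                sum (map f (filterB b L)) ≡ sum (map (λ x → if b x then f x else 0) L)
  sum-filterB b f []      = refl
  sum-filterB b f (x ∷ L) with b x
  ... | true  = cong (f x +_) (sum-filterB b f L)
  ... | false = sum-filterB b f L

-- Power series with coefficients in ℕ

shift : Series → Series
shift f = f ∘ suc

scale : ℕ → Series → Series
scale a f n = a * f n

zeroˢ : Series
zeroˢ _ = 0

constant : ℕ → Series
constant a zero    = a
constant a (suc _) = 0

⊕-cong : ∀ {f f' g g'} → f ≗ f' → g ≗ g' → (f ⊕ g) ≗ (f' ⊕ g')
⊕-cong f≗f' g≗g' n = cong₂ _+_ (f≗f' n) (g≗g' n)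

⊕-congˡ : ∀ f {g g'} → g ≗ g' → (f ⊕ g) ≗ (f ⊕ g')
⊕-congˡ f g≗g' n = cong (f n +_) (g≗g' n)

⊛-suc : ∀ f g n → (f ⊛ g) (suc n) ≡ f 0 * g (suc n) + (shift f ⊛ g) n
⊛-suc f g n = sum-unconsˡ n _

⊛-congʳ : ∀ {f f'} g → f ≗ f' → (f ⊛ g) ≗ (f' ⊛ g)
⊛-congʳ g f≗f' n = sum-cong n (λ k _ → cong (_* _) (f≗f' k))

⊛-congˡ : ∀ f {g g'} → g ≗ g' → (f ⊛ g) ≗ (f ⊛ g')
⊛-congˡ f g≗g' n = sum-cong n (λ k _ → cong (f k *_) (g≗g' _))

⊛-cong : ∀ {f f' g g'} → f ≗ f' → g ≗ g' → (f ⊛ g) ≗ (f' ⊛ g')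
⊛-cong {f} {f'} {g} {g'} f≗f' g≗g' n = trans (⊛-congʳ g f≗f' n) (⊛-congˡ f' g≗g' n)

⊛-cong-≤ : ∀ {f f' g g'} n → (∀ j → j ≤ n → f j ≡ f' j) → (∀ j → j ≤ n → g j ≡ g' j) →
           (f ⊛ g) n ≡ (f' ⊛ g') n
⊛-cong-≤ n f≡f' g≡g' = sum-cong n (λ j j≤n → cong₂ _*_ (f≡f' j j≤n) (g≡g' (n ∸ j) (m∸n≤m n j)))

⊛-comm : ∀ f g → (f ⊛ g) ≗ (g ⊛ f)
⊛-comm f g n = trans (sum-reverse n _) (sum-cong n (λ k k≤n →
  trans (cong (f (n ∸ k) *_) (cong g (m∸[m∸n]≡n k≤n))) (*-comm (f (n ∸ k)) (g k))))

⊛-zeroˡ : ∀ g → (zeroˢ ⊛ g) ≗ zeroˢ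
⊛-zeroˡ g n = sum-zero n (λ _ _ → refl)

⊛-identityˡ : ∀ g → (one ⊛ g) ≗ g
⊛-identityˡ g zero    = +-identityʳ (g 0)
⊛-identityˡ g (suc n) = trans (⊛-suc one g n)
  (trans (cong₂ _+_ (+-identityʳ (g (suc n))) (⊛-zeroˡ g n)) (+-identityʳ (g (suc n))))

⊛-distribʳ : ∀ h f g → ((f ⊕ g) ⊛ h) ≗ ((f ⊛ h) ⊕ (g ⊛ h))
⊛-distribʳ h f g n = trans (sum-cong n (λ k _ → *-distribʳ-+ (h (n ∸ k)) (f k) (g k))) (sum-+ n _ _)

scale-⊛ : ∀ a f g → (scale a f ⊛ g) ≗ scale a (f ⊛ g)
scale-⊛ a f g n = trans (sum-cong n (λ k _ → *-assoc a (f k) (g (n ∸ k)))) (sum-*ˡ n a _)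

shift-⊛ : ∀ f g → shift (f ⊛ g) ≗ (scale (f 0) (shift g) ⊕ (shift f ⊛ g))
shift-⊛ = ⊛-suc

⊛-assoc : ∀ f g h → ((f ⊛ g) ⊛ h) ≗ (f ⊛ (g ⊛ h))
⊛-assoc f g h zero    = *-assoc (f 0) (g 0) (h 0)
⊛-assoc f g h (suc n) = begin
  ((f ⊛ g) ⊛ h) (suc n)
    ≡⟨ ⊛-suc (f ⊛ g) h n ⟩
  f 0 * g 0 * h (suc n) + (shift (f ⊛ g) ⊛ h) n
    ≡⟨ cong (f 0 * g 0 * h (suc n) +_)
         (trans (⊛-congʳ h (shift-⊛ f g) n) (⊛-distribʳ h (scale (f 0) (shift g)) (shift f ⊛ g) n)) ⟩
  f 0 * g 0 * h (suc n) + ((scale (f 0) (shift g) ⊛ h) n + ((shift f ⊛ g) ⊛ h) n)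
    ≡⟨ cong (f 0 * g 0 * h (suc n) +_) (cong₂ _+_ (scale-⊛ (f 0) (shift g) h n) (⊛-assoc (shift f) g h n)) ⟩
  f 0 * g 0 * h (suc n) + (f 0 * (shift g ⊛ h) n + (shift f ⊛ (g ⊛ h)) n)
    ≡⟨ solve 5 (λ a b c d e → a :* b :* c :+ (a :* d :+ e) := a :* (b :* c :+ d) :+ e) refl
         (f 0) (g 0) (h (suc n)) ((shift g ⊛ h) n) ((shift f ⊛ (g ⊛ h)) n) ⟩
  f 0 * (g 0 * h (suc n) + (shift g ⊛ h) n) + (shift f ⊛ (g ⊛ h)) n
    ≡⟨ cong (λ x → f 0 * x + (shift f ⊛ (g ⊛ h)) n) (⊛-suc g h n) ⟨
  f 0 * (g ⊛ h) (suc n) + (shift f ⊛ (g ⊛ h)) n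
    ≡⟨ ⊛-suc f (g ⊛ h) n ⟨
  (f ⊛ (g ⊛ h)) (suc n)
    ∎
  where
  open ≡-Reasoning
  open +-*-Solver

seriesSemiring : CommutativeSemiring _ _
seriesSemiring = record
  { Carrier = Series
  ; _≈_ = _≗_
  ; _+_ = _⊕_
  ; _*_ = _⊛_
  ; 0# = zeroˢ
  ; 1# = one
  ; isCommutativeSemiring = IsCommutativeSemiringˡ.isCommutativeSemiring record
    { +-isCommutativeMonoid = Pointwise.isCommutativeMonoid ℕ +-0-isCommutativeMonoid
    ; *-isCommutativeMonoid = record
      { isMonoid = record
        { isSemigroup = record
          { isMagma = record
            { isEquivalence = Pointwise.isEquivalence ℕ isEquivalence
            ; ∙-cong = ⊛-cong
            }
          ; assoc = ⊛-assoc
          }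
        ; identity = ⊛-identityˡ , λ g n → trans (⊛-comm g one n) (⊛-identityˡ g n)
        }
      ; comm = ⊛-comm
      }
    ; distribʳ = ⊛-distribʳ
    ; zeroˡ = ⊛-zeroˡ
    }
  }

module ≈-Reasoning = SetoidReasoning (CommutativeSemiring.setoid seriesSemiring)
module SeriesSolver = NaturalSolver seriesSemiring
open Exp seriesSemiring using (^-congˡ; ^-homo-*; ^-assocʳ; ^-distrib-*) renaming (_^_ to _^ᴿ_)

-- The powers of Defs agree with the library's semiring powers, whose laws are reused below.
^ˢ≡^ᴿ : ∀ f k → f ^ˢ k ≡ f ^ᴿ k
^ˢ≡^ᴿ f zero    = refl
^ˢ≡^ᴿ f (suc k) = cong (f ⊛_) (^ˢ≡^ᴿ f k)

^ˢ-cong : ∀ {f g} k → f ≗ g → (f ^ˢ k) ≗ (g ^ˢ k)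
^ˢ-cong {f} {g} k f≗g rewrite ^ˢ≡^ᴿ f k | ^ˢ≡^ᴿ g k = ^-congˡ k f≗g

^ˢ-+ : ∀ f m n → (f ^ˢ (m + n)) ≗ ((f ^ˢ m) ⊛ (f ^ˢ n))
^ˢ-+ f m n rewrite ^ˢ≡^ᴿ f (m + n) | ^ˢ≡^ᴿ f m | ^ˢ≡^ᴿ f n = ^-homo-* f m n

^ˢ-* : ∀ f m n → (f ^ˢ (m * n)) ≗ ((f ^ˢ m) ^ˢ n)
^ˢ-* f m n rewrite ^ˢ≡^ᴿ f (m * n) | ^ˢ≡^ᴿ f m | ^ˢ≡^ᴿ (f ^ᴿ m) n = λ k → sym (^-assocʳ f m n k)

^ˢ-⊛ : ∀ f g n → ((f ⊛ g) ^ˢ n) ≗ ((f ^ˢ n) ⊛ (g ^ˢ n))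
^ˢ-⊛ f g n rewrite ^ˢ≡^ᴿ (f ⊛ g) n | ^ˢ≡^ᴿ f n | ^ˢ≡^ᴿ g n = ^-distrib-* f g n

^ˢ-square-comm : ∀ f i → ((f ^ˢ 2) ^ˢ i) ≗ ((f ^ˢ i) ^ˢ 2)
^ˢ-square-comm f i n =
  trans (sym (^ˢ-* f 2 i n)) (trans (cong (λ e → (f ^ˢ e) n) (*-comm 2 i)) (^ˢ-* f i 2 n))

shift-X : shift X ≗ one
shift-X zero    = refl
shift-X (suc n) = refl

X-⊛-suc : ∀ f n → (X ⊛ f) (suc n) ≡ f n
X-⊛-suc f n = trans (⊛-suc X f n) (trans (⊛-congʳ f shift-X n) (⊛-identityˡ f n))

X^-⊛ : ∀ j f m → ((X ^ˢ j) ⊛ f) (j + m) ≡ f m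
X^-⊛ zero    f m = ⊛-identityˡ f m
X^-⊛ (suc j) f m = trans (⊛-assoc X (X ^ˢ j) f (suc (j + m)))
  (trans (X-⊛-suc ((X ^ˢ j) ⊛ f) (j + m)) (X^-⊛ j f m))

X^-⊛-below : ∀ j f {n} → n < j → ((X ^ˢ j) ⊛ f) n ≡ 0
X^-⊛-below (suc j) f {zero}  _         = ⊛-assoc X (X ^ˢ j) f 0
X^-⊛-below (suc j) f {suc n} (s≤s n<j) = trans (⊛-assoc X (X ^ˢ j) f (suc n))
  (trans (X-⊛-suc ((X ^ˢ j) ⊛ f) n) (X^-⊛-below j f n<j))

constant-⊛ : ∀ a f → (constant a ⊛ f) ≗ scale a f
constant-⊛ a f zero    = refl
constant-⊛ a f (suc n) = trans (⊛-suc (constant a) f n)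
  (trans (cong (a * f (suc n) +_) (⊛-zeroˡ f n)) (+-identityʳ _))

constant-* : ∀ a b → constant (a * b) ≗ (constant a ⊛ constant b)
constant-* a b zero    = refl
constant-* a b (suc n) = sym (trans (constant-⊛ a (constant b) (suc n)) (*-zeroʳ a))

constant-0 : constant 0 ≗ zeroˢ
constant-0 zero    = refl
constant-0 (suc n) = refl

one≗constant : one ≗ constant 1
one≗constant zero    = refl
one≗constant (suc n) = refl

∘ˢ-congʳ : ∀ {f f'} g → f ≗ f' → (f ∘ˢ g) ≗ (f' ∘ˢ g)
∘ˢ-congʳ g f≗f' n = sum-cong n (λ k _ → cong (_* (g ^ˢ k) n) (f≗f' k))

∘ˢ-⊕ : ∀ f f' g → ((f ⊕ f') ∘ˢ g) ≗ ((f ∘ˢ g) ⊕ (f' ∘ˢ g))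
∘ˢ-⊕ f f' g n = trans (sum-cong n (λ k _ → *-distribʳ-+ ((g ^ˢ k) n) (f k) (f' k))) (sum-+ n _ _)

∘ˢ-scale : ∀ a f g → (scale a f ∘ˢ g) ≗ scale a (f ∘ˢ g)
∘ˢ-scale a f g n = trans (sum-cong n (λ k _ → *-assoc a (f k) ((g ^ˢ k) n))) (sum-*ˡ n a _)

∘ˢ-one : ∀ g → (one ∘ˢ g) ≗ one
∘ˢ-one g zero    = refl
∘ˢ-one g (suc n) = trans (sum-unconsˡ n _) (sum-zero n (λ _ _ → refl))

module WithoutConstantTerm (g : Series) (g0 : g 0 ≡ 0) where

  ^ˢ-below : ∀ {k n} → n < k → (g ^ˢ k) n ≡ 0
  ^ˢ-below {suc k} {zero}  _         = cong (_* (g ^ˢ k) 0) g0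
  ^ˢ-below {suc k} {suc n} (s≤s n<k) = trans (⊛-suc g (g ^ˢ k) n)
    (cong₂ _+_ (cong (_* (g ^ˢ k) (suc n)) g0) (sum-zero n (λ j _ →
      trans (cong (g (suc j) *_) (^ˢ-below (≤-<-trans (m∸n≤m n j) n<k))) (*-zeroʳ (g (suc j))))))

  ⊛-cong-below : ∀ {F F'} n → (∀ m → m < n → F m ≡ F' m) → (g ⊛ F) n ≡ (g ⊛ F') n
  ⊛-cong-below {F} {F'} zero    _     = trans (cong (_* F 0) g0) (sym (cong (_* F' 0) g0))
  ⊛-cong-below {F} {F'} (suc n) F≡F' = begin
    (g ⊛ F) (suc n)                      ≡⟨ ⊛-suc g F n ⟩
    g 0 * F (suc n) + (shift g ⊛ F) n    ≡⟨ cong₂ _+_ (cong (_* F (suc n)) g0)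
                                              (sum-cong n (λ k _ → cong (g (suc k) *_) (F≡F' (n ∸ k) (s≤s (m∸n≤m n k))))) ⟩
    0 + (shift g ⊛ F') n                 ≡⟨ cong (_+ (shift g ⊛ F') n) (cong (_* F' (suc n)) g0) ⟨
    g 0 * F' (suc n) + (shift g ⊛ F') n  ≡⟨ ⊛-suc g F' n ⟨
    (g ⊛ F') (suc n)                     ∎
    where open ≡-Reasoning

  ∘ˢ-extend : ∀ f {n N} → n ≤ N → (f ∘ˢ g) n ≡ sumFromTo 0 N (λ k → f k * (g ^ˢ k) n)
  ∘ˢ-extend f n≤N = sum-extend _ n≤N (λ k n<k _ → trans (cong (f k *_) (^ˢ-below n<k)) (*-zeroʳ (f k)))

  ⊛-∘ˢ : ∀ h f n → (h ⊛ (f ∘ˢ g)) n ≡ sumFromTo 0 n (λ k → f k * (h ⊛ (g ^ˢ k)) n)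
  ⊛-∘ˢ h f n = begin
    sumFromTo 0 n (λ j → h j * (f ∘ˢ g) (n ∸ j))
      ≡⟨ sum-cong n (λ j _ → cong (h j *_) (∘ˢ-extend f (m∸n≤m n j))) ⟩
    sumFromTo 0 n (λ j → h j * sumFromTo 0 n (λ k → f k * (g ^ˢ k) (n ∸ j)))
      ≡⟨ sum-cong n (λ j _ → sum-*ˡ n (h j) _) ⟨
    sumFromTo 0 n (λ j → sumFromTo 0 n (λ k → h j * (f k * (g ^ˢ k) (n ∸ j))))
      ≡⟨ sum-swap n n _ ⟩
    sumFromTo 0 n (λ k → sumFromTo 0 n (λ j → h j * (f k * (g ^ˢ k) (n ∸ j))))
      ≡⟨ sum-cong n (λ k _ → sum-cong n (λ j _ → *-left-comm (h j) (f k) _)) ⟩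
    sumFromTo 0 n (λ k → sumFromTo 0 n (λ j → f k * (h j * (g ^ˢ k) (n ∸ j))))
      ≡⟨ sum-cong n (λ k _ → sum-*ˡ n (f k) _) ⟩
    sumFromTo 0 n (λ k → f k * (h ⊛ (g ^ˢ k)) n)
      ∎
    where open ≡-Reasoning

  ∘ˢ-unfold : ∀ f → (f ∘ˢ g) ≗ (constant (f 0) ⊕ (g ⊛ (shift f ∘ˢ g)))
  ∘ˢ-unfold f zero    = trans (*-identityʳ (f 0))
    (sym (trans (cong (f 0 +_) (cong (_* (shift f ∘ˢ g) 0) g0)) (+-identityʳ (f 0))))
  ∘ˢ-unfold f (suc m) = begin
    (f ∘ˢ g) (suc m)
      ≡⟨ sum-unconsˡ m _ ⟩
    f 0 * 0 + sumFromTo 0 m (λ k → f (suc k) * (g ^ˢ suc k) (suc m))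
      ≡⟨ cong (_+ sumFromTo 0 m (λ k → f (suc k) * (g ^ˢ suc k) (suc m))) (*-zeroʳ (f 0)) ⟩
    sumFromTo 0 m (λ k → f (suc k) * (g ^ˢ suc k) (suc m))
      ≡⟨ sum-extend _ (n≤1+n m) (λ k m<k _ →
           trans (cong (f (suc k) *_) (^ˢ-below {suc k} {suc m} (s≤s m<k))) (*-zeroʳ (f (suc k)))) ⟩
    sumFromTo 0 (suc m) (λ k → f (suc k) * (g ⊛ (g ^ˢ k)) (suc m))
      ≡⟨ ⊛-∘ˢ g (shift f) (suc m) ⟨
    (g ⊛ (shift f ∘ˢ g)) (suc m)
      ∎
    where open ≡-Reasoning

  -- Strong induction on the coefficient: as g has no constant term, the n-th coefficient of
  -- g ⊛ F only involves the coefficients of F below n.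
  ∘ˢ-⊛ : ∀ f f' → ((f ⊛ f') ∘ˢ g) ≗ ((f ∘ˢ g) ⊛ (f' ∘ˢ g))
  ∘ˢ-⊛ f f' n = <-rec P step n f f'
    where
    P : ℕ → Set
    P n = ∀ f f' → ((f ⊛ f') ∘ˢ g) n ≡ ((f ∘ˢ g) ⊛ (f' ∘ˢ g)) n

    unfold-product : ∀ f f' → ((f ⊛ f') ∘ˢ g) ≗
      (constant (f 0 * f' 0) ⊕ (g ⊛ (scale (f 0) (shift f' ∘ˢ g) ⊕ ((shift f ⊛ f') ∘ˢ g))))
    unfold-product f f' m = trans (∘ˢ-unfold (f ⊛ f') m) (cong (constant (f 0 * f' 0) m +_)
      (⊛-congˡ g (λ j → trans (∘ˢ-congʳ g (shift-⊛ f f') j)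
        (trans (∘ˢ-⊕ (scale (f 0) (shift f')) (shift f ⊛ f') g j)
               (cong (_+ ((shift f ⊛ f') ∘ˢ g) j) (∘ˢ-scale (f 0) (shift f') g j)))) m))

    fold-product : ∀ f f' →
      (constant (f 0 * f' 0) ⊕ (g ⊛ (scale (f 0) (shift f' ∘ˢ g) ⊕ ((shift f ∘ˢ g) ⊛ (f' ∘ˢ g)))))
      ≗ ((f ∘ˢ g) ⊛ (f' ∘ˢ g))
    fold-product f f' = begin
      constant (f 0 * f' 0) ⊕ (g ⊛ (scale (f 0) r' ⊕ (r ⊛ (f' ∘ˢ g))))
        ≈⟨ (λ m → cong₂ _+_ (constant-* (f 0) (f' 0) m) (⊛-congˡ g (λ j →
             cong₂ _+_ (sym (constant-⊛ (f 0) r' j)) (⊛-congˡ r (∘ˢ-unfold f') j)) m)) ⟩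
      (c ⊛ c') ⊕ (g ⊛ ((c ⊛ r') ⊕ (r ⊛ (c' ⊕ (g ⊛ r')))))
        ≈⟨ solve 5 (λ c c' g r r' → (c :* c') :+ (g :* ((c :* r') :+ (r :* (c' :+ (g :* r')))))
                                    := (c :+ g :* r) :* (c' :+ g :* r')) (λ _ → refl) c c' g r r' ⟩
      (c ⊕ (g ⊛ r)) ⊛ (c' ⊕ (g ⊛ r'))
        ≈⟨ (λ m → sym (⊛-cong (∘ˢ-unfold f) (∘ˢ-unfold f') m)) ⟩
      (f ∘ˢ g) ⊛ (f' ∘ˢ g)
        ∎
      where
      open ≈-Reasoning
      open SeriesSolver
      c = constant (f 0)
      c' = constant (f' 0)
      r = shift f ∘ˢ g
      r' = shift f' ∘ˢ g

    step : ∀ n → (∀ {m} → m < n → P m) → P n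
    step n ih f f' = trans (unfold-product f f' n) (trans
      (cong (constant (f 0 * f' 0) n +_)
        (⊛-cong-below n (λ m m<n → cong (scale (f 0) (shift f' ∘ˢ g) m +_) (ih m<n (shift f) f'))))
      (fold-product f f' n))

  ∘ˢ-X : (X ∘ˢ g) ≗ g
  ∘ˢ-X n = begin
    (X ∘ˢ g) n                              ≡⟨ ∘ˢ-unfold X n ⟩
    constant 0 n + (g ⊛ (shift X ∘ˢ g)) n   ≡⟨ cong₂ _+_ (constant-0 n)
                                                 (⊛-congˡ g (λ m → trans (∘ˢ-congʳ g shift-X m) (∘ˢ-one g m)) n) ⟩
    (g ⊛ one) n                             ≡⟨ ⊛-comm g one n ⟩
    (one ⊛ g) n                             ≡⟨ ⊛-identityˡ g n ⟩
    g n                                     ∎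
    where open ≡-Reasoning

  ∘ˢ-^ : ∀ f k → ((f ^ˢ k) ∘ˢ g) ≗ ((f ∘ˢ g) ^ˢ k)
  ∘ˢ-^ f zero      = ∘ˢ-one g
  ∘ˢ-^ f (suc k) n = trans (∘ˢ-⊛ f (f ^ˢ k) n) (⊛-congˡ (f ∘ˢ g) (∘ˢ-^ f k) n)

-- Binomial coefficients and ballot numbers

C-above : ∀ {n k} → n < k → n C k ≡ 0
C-above {n} {suc k} (s≤s n≤k) rewrite <ᵇ-false n≤k = refl

C-absorption : ∀ n k → suc k * (n C suc k) + k * (n C k) ≡ n * (n C k)
C-absorption zero    zero    = refl
C-absorption zero    (suc k) = cong₂ _+_ (*-zeroʳ (suc (suc k))) (*-zeroʳ (suc k))
C-absorption (suc n) zero    = trans (cong (λ x → 1 * x + 0) (nC1≡n (suc n)))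
  (solve 1 (λ n → con 1 :* n :+ con 0 := n :* con 1) refl (suc n))
  where open +-*-Solver
C-absorption (suc n) (suc k) = begin
  2+k * (suc n C 2+k) + suc k * (suc n C suc k)
    ≡⟨ cong₂ (λ x y → 2+k * x + suc k * y) (nCk+nC[k+1]≡[n+1]C[k+1] n (suc k)) (nCk+nC[k+1]≡[n+1]C[k+1] n k) ⟨
  2+k * (b + c) + suc k * (a + b)
    ≡⟨ solve 4 (λ k a b c → (con 2 :+ k) :* (b :+ c) :+ (con 1 :+ k) :* (a :+ b)
                            := ((con 2 :+ k) :* c :+ (con 1 :+ k) :* b) :+ ((con 1 :+ k) :* b :+ k :* a) :+ (a :+ b))
         refl k a b c ⟩
  (2+k * c + suc k * b) + (suc k * b + k * a) + (a + b)
    ≡⟨ cong₂ (λ x y → x + y + (a + b)) (C-absorption n (suc k)) (C-absorption n k) ⟩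
  n * b + n * a + (a + b)
    ≡⟨ solve 3 (λ n a b → n :* b :+ n :* a :+ (a :+ b) := (con 1 :+ n) :* (a :+ b)) refl n a b ⟩
  suc n * (a + b)
    ≡⟨ cong (suc n *_) (nCk+nC[k+1]≡[n+1]C[k+1] n k) ⟩
  suc n * (suc n C suc k)
    ∎
  where
  open ≡-Reasoning
  open +-*-Solver
  2+k = suc (suc k)
  a = n C k
  b = n C suc k
  c = n C 2+k

-- Coefficients of the powers of the Catalan series: C = 1 + t C² gives C^(r+1) = C^r + t C^(r+2).
ballot : ℕ → ℕ → ℕ
ballot zero    zero    = 1
ballot zero    (suc k) = 0
ballot (suc r) zero    = 1
ballot (suc r) (suc k) = ballot r (suc k) + ballot (suc (suc r)) k

-- The inductive step of ballot-formula at (s+1, j+1), with N = 2j+s+2: the hypotheses are the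
-- formula at (s, j+1) and (s+2, j), and C-absorption at N.
ballot-step : ∀ j s b₁ b₂ c d → let N = suc (suc (2 * j + s)) in
  N * b₁ ≡ s * d → N * b₂ ≡ suc (suc s) * c → suc j * d + j * c ≡ N * c →
  suc N * (b₁ + b₂) ≡ suc s * (c + d)
ballot-step j s b₁ b₂ c d h₁ h₂ h₃ = *-cancelˡ-≡ _ _ (suc j) (*-cancelˡ-≡ _ _ N (begin
    N * (suc j * (suc N * (b₁ + b₂)))
      ≡⟨ solve 4 (λ j s b₁ b₂ → N' j s :* ((con 1 :+ j) :* ((con 1 :+ N' j s) :* (b₁ :+ b₂)))
                                := (con 1 :+ N' j s) :* ((con 1 :+ j) :* (N' j s :* b₁) :+ (con 1 :+ j) :* (N' j s :* b₂)))
           refl j s b₁ b₂ ⟩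
    suc N * (suc j * (N * b₁) + suc j * (N * b₂))
      ≡⟨ cong₂ (λ x y → suc N * (suc j * x + suc j * y)) h₁ h₂ ⟩
    suc N * (suc j * (s * d) + suc j * (suc (suc s) * c))
      ≡⟨ solve 4 (λ j s c d → (con 1 :+ N' j s) :* ((con 1 :+ j) :* (s :* d) :+ (con 1 :+ j) :* ((con 2 :+ s) :* c))
                              := (con 1 :+ N' j s) :* (s :* ((con 1 :+ j) :* d) :+ (con 1 :+ j) :* (con 2 :+ s) :* c))
           refl j s c d ⟩
    suc N * (s * (suc j * d) + suc j * suc (suc s) * c)
      ≡⟨ cong (λ x → suc N * (s * x + suc j * suc (suc s) * c)) [1+j]d≡ ⟩
    suc N * (s * ((j + s + 2) * c) + suc j * suc (suc s) * c)
      ≡⟨ solve 3 (λ j s c → (con 1 :+ N' j s) :* (s :* ((j :+ s :+ con 2) :* c) :+ (con 1 :+ j) :* (con 2 :+ s) :* c)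
                            := N' j s :* ((con 1 :+ s) :* ((con 1 :+ j) :* c :+ (j :+ s :+ con 2) :* c)))
           refl j s c ⟩
    N * (suc s * (suc j * c + (j + s + 2) * c))
      ≡⟨ cong (λ x → N * (suc s * (suc j * c + x))) [1+j]d≡ ⟨
    N * (suc s * (suc j * c + suc j * d))
      ≡⟨ solve 4 (λ j s c d → N' j s :* ((con 1 :+ s) :* ((con 1 :+ j) :* c :+ (con 1 :+ j) :* d))
                              := N' j s :* ((con 1 :+ j) :* ((con 1 :+ s) :* (c :+ d))))
           refl j s c d ⟩
    N * (suc j * (suc s * (c + d)))
      ∎))
  where
  open ≡-Reasoning
  open +-*-Solver
  N = suc (suc (2 * j + s))
  N' : ∀ {n} → Polynomial n → Polynomial n → Polynomial n
  N' j s = con 2 :+ (con 2 :* j :+ s)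
  [1+j]d≡ : suc j * d ≡ (j + s + 2) * c
  [1+j]d≡ = +-cancelʳ-≡ (j * c) _ _
    (trans h₃ (solve 3 (λ j s c → N' j s :* c := (j :+ s :+ con 2) :* c :+ j :* c) refl j s c))

ballot-formula : ∀ r k → (2 * k + r) * ballot r k ≡ r * ((2 * k + r) C k)
ballot-formula zero    zero    = refl
ballot-formula zero    (suc k) = *-zeroʳ (2 * suc k + 0)
ballot-formula (suc r) zero    = refl
ballot-formula (suc s) (suc j) = combine (ballot-formula s (suc j)) (ballot-formula (suc (suc s)) j)
  where
  open +-*-Solver
  N = suc (suc (2 * j + s))
  2[1+j]+s≡N : 2 * suc j + s ≡ N
  2[1+j]+s≡N = solve 2 (λ j s → con 2 :* (con 1 :+ j) :+ s := con 2 :+ (con 2 :* j :+ s)) refl j s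
  2j+[2+s]≡N : 2 * j + suc (suc s) ≡ N
  2j+[2+s]≡N = solve 2 (λ j s → con 2 :* j :+ (con 2 :+ s) := con 2 :+ (con 2 :* j :+ s)) refl j s
  2[1+j]+[1+s]≡1+N : 2 * suc j + suc s ≡ suc N
  2[1+j]+[1+s]≡1+N = solve 2 (λ j s → con 2 :* (con 1 :+ j) :+ (con 1 :+ s) := con 3 :+ (con 2 :* j :+ s)) refl j s

  combine : (2 * suc j + s) * ballot s (suc j) ≡ s * ((2 * suc j + s) C suc j) →
            (2 * j + suc (suc s)) * ballot (suc (suc s)) j ≡ suc (suc s) * ((2 * j + suc (suc s)) C j) →
            (2 * suc j + suc s) * ballot (suc s) (suc j) ≡ suc s * ((2 * suc j + suc s) C suc j)
  combine IH₁ IH₂ = subst (λ M → M * ballot (suc s) (suc j) ≡ suc s * (M C suc j)) (sym 2[1+j]+[1+s]≡1+N)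
    (trans (ballot-step j s (ballot s (suc j)) (ballot (suc (suc s)) j) (N C j) (N C suc j)
             (subst (λ M → M * ballot s (suc j) ≡ s * (M C suc j)) 2[1+j]+s≡N IH₁)
             (subst (λ M → M * ballot (suc (suc s)) j ≡ suc (suc s) * (M C j)) 2j+[2+s]≡N IH₂)
             (C-absorption N j))
           (cong (suc s *_) (nCk+nC[k+1]≡[n+1]C[k+1] N j)))

/-exact : ∀ {m n q} .{{_ : NonZero n}} → n * q ≡ m → m / n ≡ q
/-exact {m} {n} {q} n*q≡m = trans (cong (_/ n) (trans (sym n*q≡m) (*-comm n q))) (m*n/n≡m q n)

catalan-ballot : ∀ n → suc n * ballot 1 n ≡ (2 * n) C n
catalan-ballot zero    = refl
catalan-ballot (suc m) = *-cancelˡ-≡ _ _ (suc (2 * n)) (begin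
  suc (2 * n) * (suc n * ballot 1 n)  ≡⟨ solve 2 (λ n x → (con 1 :+ con 2 :* n) :* ((con 1 :+ n) :* x)
                                                        := (con 1 :+ n) :* ((con 1 :+ con 2 :* n) :* x)) refl n (ballot 1 n) ⟩
  suc n * (suc (2 * n) * ballot 1 n)  ≡⟨ cong (suc n *_) [2n+1]ballot≡ ⟩
  suc n * (a + e)                     ≡⟨ *-distribˡ-+ (suc n) a e ⟩
  suc n * a + suc n * e               ≡⟨ cong (_+ suc n * e) n*e≡[1+n]*a ⟨
  n * e + suc n * e                   ≡⟨ solve 2 (λ n e → n :* e :+ (con 1 :+ n) :* e := (con 1 :+ con 2 :* n) :* e) refl n e ⟩
  suc (2 * n) * e                     ∎)
  where
  open ≡-Reasoning
  open +-*-Solver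
  n = suc m
  a = (2 * n) C m
  e = (2 * n) C n
  [2n+1]ballot≡ : suc (2 * n) * ballot 1 n ≡ a + e
  [2n+1]ballot≡ = begin
    suc (2 * n) * ballot 1 n  ≡⟨ cong (_* ballot 1 n) (+-comm 1 (2 * n)) ⟩
    (2 * n + 1) * ballot 1 n  ≡⟨ ballot-formula 1 n ⟩
    1 * ((2 * n + 1) C n)     ≡⟨ *-identityˡ _ ⟩
    (2 * n + 1) C n           ≡⟨ cong (_C n) (+-comm (2 * n) 1) ⟩
    suc (2 * n) C n           ≡⟨ nCk+nC[k+1]≡[n+1]C[k+1] (2 * n) m ⟨
    a + e                     ∎
  n*e≡[1+n]*a : n * e ≡ suc n * a
  n*e≡[1+n]*a = +-cancelʳ-≡ (m * a) _ _ (trans (C-absorption (2 * n) m)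
    (solve 2 (λ m a → (con 2 :* (con 1 :+ m)) :* a := (con 2 :+ m) :* a :+ m :* a) refl m a))

catalanGF≗ballot : catalanGF ≗ ballot 1
catalanGF≗ballot n = /-exact (catalan-ballot n)

B≡ballot : ∀ i k → B (i + k) i ≡ ballot (2 * i + 3) k
B≡ballot i k = /-exact (begin
  suc (suc (suc (2 * (i + k)))) * ballot (2 * i + 3) k
    ≡⟨ cong (_* ballot (2 * i + 3) k) 3+2[i+k]≡2k+[2i+3] ⟩
  (2 * k + (2 * i + 3)) * ballot (2 * i + 3) k
    ≡⟨ ballot-formula (2 * i + 3) k ⟩
  (2 * i + 3) * ((2 * k + (2 * i + 3)) C k)
    ≡⟨ cong₂ (λ x y → (2 * i + 3) * (x C y))
         (trans (sym 3+2[i+k]≡2k+[2i+3]) (+-comm 3 (2 * (i + k)))) (sym (m+n∸m≡n i k)) ⟩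
  (2 * i + 3) * ((2 * (i + k) + 3) C ((i + k) ∸ i))
    ∎)
  where
  open ≡-Reasoning
  open +-*-Solver
  3+2[i+k]≡2k+[2i+3] : suc (suc (suc (2 * (i + k)))) ≡ 2 * k + (2 * i + 3)
  3+2[i+k]≡2k+[2i+3] = solve 2 (λ i k → con 3 :+ con 2 :* (i :+ k) := con 2 :* k :+ (con 2 :* i :+ con 3)) refl i k

ballot-0 : ∀ r → ballot r 0 ≡ 1
ballot-0 zero    = refl
ballot-0 (suc r) = refl

ballot1-⊛ : ∀ r → (ballot 1 ⊛ ballot r) ≗ ballot (suc r)
ballot1-⊛ r n = <-rec P step n r
  where
  P : ℕ → Set
  P n = ∀ r → (ballot 1 ⊛ ballot r) n ≡ ballot (suc r) n
  step : ∀ n → (∀ {m} → m < n → P m) → P n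
  step zero    _  r = trans (+-identityʳ _) (ballot-0 r)
  step (suc k) ih r = begin
    (ballot 1 ⊛ ballot r) (suc k)
      ≡⟨ ⊛-suc (ballot 1) (ballot r) k ⟩
    1 * ballot r (suc k) + (ballot 2 ⊛ ballot r) k
      ≡⟨ cong₂ _+_ (*-identityˡ _) (⊛-cong-≤ {ballot 2} {ballot 1 ⊛ ballot 1} {ballot r} k
                                      (λ j j≤k → sym (ih (s≤s j≤k) 1)) (λ _ _ → refl)) ⟩
    ballot r (suc k) + ((ballot 1 ⊛ ballot 1) ⊛ ballot r) k
      ≡⟨ cong (ballot r (suc k) +_) (⊛-assoc (ballot 1) (ballot 1) (ballot r) k) ⟩
    ballot r (suc k) + (ballot 1 ⊛ (ballot 1 ⊛ ballot r)) k
      ≡⟨ cong (ballot r (suc k) +_) (⊛-cong-≤ {ballot 1} {ballot 1} {ballot 1 ⊛ ballot r} k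
                                       (λ _ _ → refl) (λ j j≤k → ih (s≤s j≤k) r)) ⟩
    ballot r (suc k) + (ballot 1 ⊛ ballot (suc r)) k
      ≡⟨ cong (ballot r (suc k) +_) (ih ≤-refl (suc r)) ⟩
    ballot (suc r) (suc k)
      ∎
    where open ≡-Reasoning

ballot1-^ : ∀ r → (ballot 1 ^ˢ r) ≗ ballot r
ballot1-^ zero    zero    = refl
ballot1-^ zero    (suc n) = refl
ballot1-^ (suc r) n       = trans (⊛-congˡ (ballot 1) (ballot1-^ r) n) (ballot1-⊛ r n)

ballot1-equation : ballot 1 ≗ (one ⊕ (X ⊛ (ballot 1 ⊛ ballot 1)))
ballot1-equation zero    = refl
ballot1-equation (suc k) = sym (trans (X-⊛-suc (ballot 1 ⊛ ballot 1) k) (ballot1-⊛ 1 k))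

-- The explicit formula

K : Series
K = catalanGF ∘ˢ hArg

open WithoutConstantTerm hArg refl

K≗ballot1∘hArg : K ≗ (ballot 1 ∘ˢ hArg)
K≗ballot1∘hArg = ∘ˢ-congʳ hArg catalanGF≗ballot

K^ : ∀ r → (K ^ˢ r) ≗ (ballot r ∘ˢ hArg)
K^ r n = trans (^ˢ-cong r K≗ballot1∘hArg n)
  (trans (sym (∘ˢ-^ (ballot 1) r n)) (∘ˢ-congʳ hArg (ballot1-^ r) n))

K-equation : K ≗ (one ⊕ (hArg ⊛ (K ⊛ K)))
K-equation = begin
  K
    ≈⟨ K≗ballot1∘hArg ⟩
  ballot 1 ∘ˢ hArg
    ≈⟨ ∘ˢ-congʳ hArg ballot1-equation ⟩
  (one ⊕ (X ⊛ (ballot 1 ⊛ ballot 1))) ∘ˢ hArg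
    ≈⟨ ∘ˢ-⊕ one (X ⊛ (ballot 1 ⊛ ballot 1)) hArg ⟩
  (one ∘ˢ hArg) ⊕ ((X ⊛ (ballot 1 ⊛ ballot 1)) ∘ˢ hArg)
    ≈⟨ ⊕-cong (∘ˢ-one hArg) (∘ˢ-⊛ X (ballot 1 ⊛ ballot 1)) ⟩
  one ⊕ ((X ∘ˢ hArg) ⊛ ((ballot 1 ⊛ ballot 1) ∘ˢ hArg))
    ≈⟨ ⊕-congˡ one (⊛-cong ∘ˢ-X (∘ˢ-⊛ (ballot 1) (ballot 1))) ⟩
  one ⊕ (hArg ⊛ ((ballot 1 ∘ˢ hArg) ⊛ (ballot 1 ∘ˢ hArg)))
    ≈⟨ ⊕-congˡ one (⊛-congˡ hArg (⊛-cong K⁻ K⁻)) ⟩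
  one ⊕ (hArg ⊛ (K ⊛ K))
    ∎
  where
  open ≈-Reasoning
  K⁻ : (ballot 1 ∘ˢ hArg) ≗ K
  K⁻ n = sym (K≗ballot1∘hArg n)

binomial-series : ∀ j → ((one ⊕ X) ^ˢ j) ≗ (j C_)
binomial-series zero    zero    = refl
binomial-series zero    (suc k) = refl
binomial-series (suc j) n       =
  trans (⊛-distribʳ P one X n) (trans (cong (_+ (X ⊛ P) n) (⊛-identityˡ P n)) (pascal n))
  where
  P = (one ⊕ X) ^ˢ j
  pascal : ∀ n → P n + (X ⊛ P) n ≡ suc j C n
  pascal zero    = trans (+-identityʳ (P 0)) (binomial-series j 0)
  pascal (suc k) = trans (cong₂ _+_ (binomial-series j (suc k)) (trans (X-⊛-suc P k) (binomial-series j k)))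
    (trans (+-comm (j C suc k) (j C k)) (nCk+nC[k+1]≡[n+1]C[k+1] j k))

negative-binomial : ∀ M t → (geom ^ˢ suc M) t ≡ (t + M) C t
negative-binomial zero    t = begin
  (geom ⊛ one) t  ≡⟨ ⊛-comm geom one t ⟩
  (one ⊛ geom) t  ≡⟨ ⊛-identityˡ geom t ⟩
  1               ≡⟨ nCn≡1 t ⟨
  t C t           ≡⟨ cong (_C t) (+-identityʳ t) ⟨
  (t + 0) C t     ∎
  where open ≡-Reasoning
negative-binomial (suc M) zero    = trans (+-identityʳ _) (negative-binomial M 0)
negative-binomial (suc M) (suc t) = begin
  (geom ⊛ (geom ^ˢ suc M)) (suc t)
    ≡⟨ ⊛-suc geom (geom ^ˢ suc M) t ⟩
  1 * (geom ^ˢ suc M) (suc t) + (geom ⊛ (geom ^ˢ suc M)) t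
    ≡⟨ cong₂ _+_ (trans (*-identityˡ _) (negative-binomial M (suc t))) (negative-binomial (suc M) t) ⟩
  suc (t + M) C suc t + (t + suc M) C t
    ≡⟨ cong (λ x → x C suc t + (t + suc M) C t) (+-suc t M) ⟨
  (t + suc M) C suc t + (t + suc M) C t
    ≡⟨ +-comm ((t + suc M) C suc t) _ ⟩
  (t + suc M) C t + (t + suc M) C suc t
    ≡⟨ nCk+nC[k+1]≡[n+1]C[k+1] (t + suc M) t ⟩
  suc (t + suc M) C suc t
    ∎
  where open ≡-Reasoning

E : ℕ → Series
E j = (geom ^ˢ 3) ⊛ (hArg ^ˢ j)

E-factorisation : ∀ j → E j ≗ ((X ^ˢ j) ⊛ (((one ⊕ X) ^ˢ j) ⊛ (geom ^ˢ suc (2 * j + 2))))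
E-factorisation j = begin
  (geom ^ˢ 3) ⊛ (hArg ^ˢ j)
    ≈⟨ ⊛-congˡ (geom ^ˢ 3) (λ n → trans (^ˢ-⊛ (X ⊛ (one ⊕ X)) (geom ^ˢ 2) j n)
         (⊛-cong (^ˢ-⊛ X (one ⊕ X) j) (λ m → sym (^ˢ-* geom 2 j m)) n)) ⟩
  (geom ^ˢ 3) ⊛ (((X ^ˢ j) ⊛ ((one ⊕ X) ^ˢ j)) ⊛ (geom ^ˢ (2 * j)))
    ≈⟨ solve 4 (λ g³ xʲ pʲ g²ʲ → g³ :* ((xʲ :* pʲ) :* g²ʲ) := xʲ :* (pʲ :* (g²ʲ :* g³))) (λ _ → refl)
         (geom ^ˢ 3) (X ^ˢ j) ((one ⊕ X) ^ˢ j) (geom ^ˢ (2 * j)) ⟩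
  (X ^ˢ j) ⊛ (((one ⊕ X) ^ˢ j) ⊛ ((geom ^ˢ (2 * j)) ⊛ (geom ^ˢ 3)))
    ≈⟨ ⊛-congˡ (X ^ˢ j) (⊛-congˡ ((one ⊕ X) ^ˢ j) (λ n → trans (sym (^ˢ-+ geom (2 * j) 3 n))
         (cong (λ e → (geom ^ˢ e) n) (trans (+-comm (2 * j) 3) (cong suc (+-comm 2 (2 * j))))))) ⟩
  (X ^ˢ j) ⊛ (((one ⊕ X) ^ˢ j) ⊛ (geom ^ˢ suc (2 * j + 2)))
    ∎
  where
  open ≈-Reasoning
  open SeriesSolver

E-below : ∀ j {n} → n < j → E j n ≡ 0
E-below j {n} n<j =
  trans (E-factorisation j n) (X^-⊛-below j (((one ⊕ X) ^ˢ j) ⊛ (geom ^ˢ suc (2 * j + 2))) n<j)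

innerBinom-split : ∀ j k d → innerBinom (j + (k + d)) j k ≡ (d + (2 * j + 2)) C d
innerBinom-split j k d rewrite <ᵇ-false (+-monoʳ-≤ j (m≤m+n k d)) = cong₂ _C_
  (trans (cong (_∸ k) (solve 3 (λ j k d → j :+ (k :+ d) :+ j :+ con 2 := k :+ (d :+ (con 2 :* j :+ con 2))) refl j k d))
         (m+n∸m≡n k _))
  (trans ([m+n]∸[m+o]≡n∸o j (k + d) k) (m+n∸m≡n k d))
  where open +-*-Solver

innerBinom-above : ∀ {j m k} → m < k → innerBinom (j + m) j k ≡ 0
innerBinom-above {j} m<k rewrite <ᵇ-true (+-monoʳ-< j m<k) = refl

innerSum : ℕ → ℕ → ℕ
innerSum n j = sumFromTo 0 j (λ k → (j C k) * innerBinom n j k)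

E-coefficient : ∀ j m → E j (j + m) ≡ innerSum (j + m) j
E-coefficient j m = begin
  E j (j + m)
    ≡⟨ E-factorisation j (j + m) ⟩
  ((X ^ˢ j) ⊛ (((one ⊕ X) ^ˢ j) ⊛ (geom ^ˢ suc (2 * j + 2)))) (j + m)
    ≡⟨ X^-⊛ j (((one ⊕ X) ^ˢ j) ⊛ (geom ^ˢ suc (2 * j + 2))) m ⟩
  sumFromTo 0 m (λ k → ((one ⊕ X) ^ˢ j) k * (geom ^ˢ suc (2 * j + 2)) (m ∸ k))
    ≡⟨ sum-cong m (λ k k≤m → cong₂ _*_ (binomial-series j k) (term k k≤m)) ⟩
  sumFromTo 0 m T
    ≡⟨ sum-extend T (m≤n+m m j) (λ k m<k _ →
         trans (cong ((j C k) *_) (innerBinom-above {j} m<k)) (*-zeroʳ (j C k))) ⟩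
  sumFromTo 0 (j + m) T
    ≡⟨ sum-extend T (m≤m+n j m) (λ k j<k _ → cong (_* innerBinom (j + m) j k) (C-above j<k)) ⟨
  innerSum (j + m) j
    ∎
  where
  open ≡-Reasoning
  T : ℕ → ℕ
  T k = (j C k) * innerBinom (j + m) j k
  term : ∀ k → k ≤ m → (geom ^ˢ suc (2 * j + 2)) (m ∸ k) ≡ innerBinom (j + m) j k
  term k k≤m = trans (negative-binomial (2 * j + 2) (m ∸ k))
    (trans (sym (innerBinom-split j k (m ∸ k))) (cong (λ x → innerBinom (j + x) j k) (m+[n∸m]≡n k≤m)))

riordan-factorisation : ∀ i → (riordanD ⊛ (riordanH ^ˢ i)) ≗ (E i ⊛ (K ^ˢ (2 * i + 3)))
riordan-factorisation i = begin
  ((geom ^ˢ 3) ⊛ (K ^ˢ 3)) ⊛ ((hArg ⊛ (K ^ˢ 2)) ^ˢ i)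
    ≈⟨ ⊛-congˡ ((geom ^ˢ 3) ⊛ (K ^ˢ 3)) (λ n →
         trans (^ˢ-⊛ hArg (K ^ˢ 2) i n) (⊛-congˡ (hArg ^ˢ i) (λ m → sym (^ˢ-* K 2 i m)) n)) ⟩
  ((geom ^ˢ 3) ⊛ (K ^ˢ 3)) ⊛ ((hArg ^ˢ i) ⊛ (K ^ˢ (2 * i)))
    ≈⟨ solve 4 (λ g³ k³ hⁱ k²ⁱ → (g³ :* k³) :* (hⁱ :* k²ⁱ) := (g³ :* hⁱ) :* (k²ⁱ :* k³)) (λ _ → refl)
         (geom ^ˢ 3) (K ^ˢ 3) (hArg ^ˢ i) (K ^ˢ (2 * i)) ⟩
  E i ⊛ ((K ^ˢ (2 * i)) ⊛ (K ^ˢ 3))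
    ≈⟨ ⊛-congˡ (E i) (λ n → sym (^ˢ-+ K (2 * i) 3 n)) ⟩
  E i ⊛ (K ^ˢ (2 * i + 3))
    ∎
  where
  open ≈-Reasoning
  open SeriesSolver

riordanEntry-expansion : ∀ n i →
  riordanEntry riordanD riordanH n i ≡ sumFromTo 0 n (λ k → ballot (2 * i + 3) k * E (i + k) n)
riordanEntry-expansion n i = begin
  (riordanD ⊛ (riordanH ^ˢ i)) n
    ≡⟨ riordan-factorisation i n ⟩
  (E i ⊛ (K ^ˢ r)) n
    ≡⟨ ⊛-congˡ (E i) (K^ r) n ⟩
  (E i ⊛ (ballot r ∘ˢ hArg)) n
    ≡⟨ ⊛-∘ˢ (E i) (ballot r) n ⟩
  sumFromTo 0 n (λ k → ballot r k * (E i ⊛ (hArg ^ˢ k)) n)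
    ≡⟨ sum-cong n (λ k _ → cong (ballot r k *_) (E-shift k)) ⟩
  sumFromTo 0 n (λ k → ballot r k * E (i + k) n)
    ∎
  where
  open ≡-Reasoning
  r = 2 * i + 3
  E-shift : ∀ k → (E i ⊛ (hArg ^ˢ k)) n ≡ E (i + k) n
  E-shift k = trans (⊛-assoc (geom ^ˢ 3) (hArg ^ˢ i) (hArg ^ˢ k) n)
    (⊛-congˡ (geom ^ˢ 3) (λ m → sym (^ˢ-+ hArg i k m)) n)

riordanEntry≡formula : ∀ n i → i ≤ n → riordanEntry riordanD riordanH n i ≡ formula n i
riordanEntry≡formula n i i≤n = begin
  riordanEntry riordanD riordanH n i
    ≡⟨ riordanEntry-expansion n i ⟩
  sumFromTo 0 n (λ k → ballot r k * E (i + k) n)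
    ≡⟨ sum-extend _ (m∸n≤m n i) (λ k d<k _ →
         trans (cong (ballot r k *_) (E-below (i + k) (n<i+k d<k))) (*-zeroʳ (ballot r k))) ⟨
  sumFromTo 0 d (λ k → ballot r k * E (i + k) n)
    ≡⟨ sum-cong d (λ k k≤d → cong₂ _*_ (sym (B≡ballot i k)) (coefficient k k≤d)) ⟩
  sumFromTo 0 d (λ k → B (i + k) i * innerSum n (i + k))
    ≡⟨ sumFromTo-offset i d (λ j → B j i * innerSum n j) ⟨
  sumFromTo i (i + d) (λ j → B j i * innerSum n j)
    ≡⟨ cong (λ x → sumFromTo i x (λ j → B j i * innerSum n j)) (m+[n∸m]≡n i≤n) ⟩
  formula n i
    ∎
  where
  open ≡-Reasoning
  r = 2 * i + 3
  d = n ∸ i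
  n<i+k : ∀ {k} → d < k → n < i + k
  n<i+k {k} d<k = subst (_< i + k) (m+[n∸m]≡n i≤n) (+-monoʳ-< i d<k)
  coefficient : ∀ k → k ≤ d → E (i + k) n ≡ innerSum n (i + k)
  coefficient k k≤d = subst (λ x → E (i + k) x ≡ innerSum x (i + k))
    (trans (+-assoc i k (d ∸ k)) (trans (cong (i +_) (m+[n∸m]≡n k≤d)) (m+[n∸m]≡n i≤n)))
    (E-coefficient (i + k) (d ∸ k))

-- Counting paths by their first step

isGMotzkinFrom : ℕ → ℕ → List Step → Bool
isGMotzkinFrom y m p = isZero? (walk y p) ∧ (hlen p ≡ᵇ m)

pathSum : (List Step → ℕ) → ℕ → ℕ → ℕ → ℕ
pathSum w k y m = sum (map (λ p → if isGMotzkinFrom y m p then w p else 0) (allLists k))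

pathCount : ℕ → ℕ → ℕ → ℕ
pathCount = pathSum (λ _ → 1)

stepCount : Step → ℕ → ℕ → ℕ → ℕ → ℕ
stepCount s i k y m = pathSum (countAt s i y) k y m

marks : Step → ℕ → Step → ℕ → ℕ
marks s i t y' = if sameStep s t ∧ (y' ≡ᵇ i) then 1 else 0

data FirstStep : ℕ → ℕ → Step → ℕ → ℕ → Set where
  up   : ∀ {y m} → FirstStep y (suc m) U (suc y) m
  flat : ∀ {y m} → FirstStep y (suc m) H y m
  down : ∀ {y m} → FirstStep (suc y) (suc m) D y m
  drop : ∀ {y m} → FirstStep (suc y) m V y m

firstSteps : (Step → ℕ → ℕ → ℕ) → ℕ → ℕ → ℕ
firstSteps F zero    zero    = 0
firstSteps F zero    (suc m) = F U 1 m + F H 0 m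
firstSteps F (suc y) zero    = F V y 0
firstSteps F (suc y) (suc m) = F U (suc (suc y)) m + F H (suc y) m + F D y m + F V y (suc m)

firstSteps-cong : ∀ {F G} y m → (∀ {t y' m'} → FirstStep y m t y' m' → F t y' m' ≡ G t y' m') →
                  firstSteps F y m ≡ firstSteps G y m
firstSteps-cong zero    zero    F≡G = refl
firstSteps-cong zero    (suc m) F≡G = cong₂ _+_ (F≡G up) (F≡G flat)
firstSteps-cong (suc y) zero    F≡G = F≡G drop
firstSteps-cong (suc y) (suc m) F≡G =
  cong₂ _+_ (cong₂ _+_ (cong₂ _+_ (F≡G up) (F≡G flat)) (F≡G down)) (F≡G drop)

firstSteps-+ : ∀ F G y m →
  firstSteps (λ t y' m' → F t y' m' + G t y' m') y m ≡ firstSteps F y m + firstSteps G y m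
firstSteps-+ F G zero    zero    = refl
firstSteps-+ F G zero    (suc m) = +-interchange (F U 1 m) (G U 1 m) (F H 0 m) (G H 0 m)
firstSteps-+ F G (suc y) zero    = refl
firstSteps-+ F G (suc y) (suc m) =
  solve 8 (λ a b c d e f g h → a :+ b :+ (c :+ d) :+ (e :+ f) :+ (g :+ h) := a :+ c :+ e :+ g :+ (b :+ d :+ f :+ h))
    refl (F U (suc (suc y)) m) (G U (suc (suc y)) m) (F H (suc y) m) (G H (suc y) m)
         (F D y m) (G D y m) (F V y (suc m)) (G V y (suc m))
  where open +-*-Solver

FirstStep-potential : ∀ {y m t y' m'} → FirstStep y m t y' m' → 2 * m' + y' < 2 * m + y
FirstStep-potential {y}     {suc m} up   = ≤-reflexive
  (solve 2 (λ y m → con 1 :+ (con 2 :* m :+ (con 1 :+ y)) := con 2 :* (con 1 :+ m) :+ y) refl y m)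
  where open +-*-Solver
FirstStep-potential {y}     {suc m} flat = ≤-trans (m≤n+m _ 1) (≤-reflexive
  (solve 2 (λ y m → con 2 :+ (con 2 :* m :+ y) := con 2 :* (con 1 :+ m) :+ y) refl y m))
  where open +-*-Solver
FirstStep-potential {suc y} {suc m} down = ≤-trans (m≤n+m _ 2) (≤-reflexive
  (solve 2 (λ y m → con 3 :+ (con 2 :* m :+ y) := con 2 :* (con 1 :+ m) :+ (con 1 :+ y)) refl y m))
  where open +-*-Solver
FirstStep-potential {suc y} {m}     drop = ≤-reflexive (sym (+-suc (2 * m) y))

fuel-step : ∀ {y m t y' m' k} → FirstStep y m t y' m' → 2 * m + y ≤ suc k → 2 * m' + y' ≤ k
fuel-step step fuel = ≤-pred (≤-trans (FirstStep-potential step) fuel)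

-- A path from height y of length m has at most 2m + y steps; so counts over the step sequences of
-- length ≤ k that obey the first-step recursion agree with any solution of it when 2m + y ≤ k.
unique-solution : ∀ (F : ℕ → ℕ → ℕ → ℕ) (Sol src : ℕ → ℕ → ℕ) →
  (∀ y m → Sol y m ≡ src y m + firstSteps (λ _ → Sol) y m) →
  F 0 0 0 ≡ Sol 0 0 →
  (∀ k y m → 2 * m + y ≤ suc k → F (suc k) y m ≡ src y m + firstSteps (λ _ → F k) y m) →
  ∀ k y m → 2 * m + y ≤ k → F k y m ≡ Sol y m
unique-solution F Sol src Sol-rec F00 F-rec zero    zero    zero    _    = F00
unique-solution F Sol src Sol-rec F00 F-rec zero    zero    (suc m) ()
unique-solution F Sol src Sol-rec F00 F-rec zero    (suc y) m       fuel =
  contradiction (subst (_≤ 0) (+-suc (2 * m) y) fuel) λ ()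
unique-solution F Sol src Sol-rec F00 F-rec (suc k) y       m       fuel = begin
  F (suc k) y m                           ≡⟨ F-rec k y m fuel ⟩
  src y m + firstSteps (λ _ → F k) y m    ≡⟨ cong (src y m +_) (firstSteps-cong y m (λ {_} {y'} {m'} step →
                                               unique-solution F Sol src Sol-rec F00 F-rec k y' m' (fuel-step step fuel))) ⟩
  src y m + firstSteps (λ _ → Sol) y m    ≡⟨ Sol-rec y m ⟨
  Sol y m                                 ∎
  where open ≡-Reasoning

sum-map-allLists-suc : ∀ (f : List Step → ℕ) k → let Σ = λ t → sum (map (f ∘ (t ∷_)) (allLists k)) in
  sum (map f (allLists (suc k))) ≡ f [] + (Σ U + (Σ D + (Σ H + (Σ V + 0))))
sum-map-allLists-suc f k = cong (f [] +_)
  (trans (sum-map-++ f (map (U ∷_) L) _) (cong₂ _+_ (branch U)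
  (trans (sum-map-++ f (map (D ∷_) L) _) (cong₂ _+_ (branch D)
  (trans (sum-map-++ f (map (H ∷_) L) _) (cong₂ _+_ (branch H)
  (trans (sum-map-++ f (map (V ∷_) L) _) (cong₂ _+_ (branch V) refl))))))))
  where
  L = allLists k
  branch : ∀ t → sum (map f (map (t ∷_) L)) ≡ sum (map (f ∘ (t ∷_)) L)
  branch t = cong sum (sym (map-∘ L))

if-∧-false : ∀ b (x : ℕ) → (if b ∧ false then x else 0) ≡ 0
if-∧-false b x rewrite ∧-zeroʳ b = refl

pathSum-suc : ∀ w k y m → pathSum w (suc k) y m ≡
  (if isGMotzkinFrom y m [] then w [] else 0) + firstSteps (λ t y' m' → pathSum (w ∘ (t ∷_)) k y' m') y m
pathSum-suc w k y m = trans (sum-map-allLists-suc _ k) (cong (_ +_) (by-first-step y m))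
  where
  L = allLists k
  Σ : ℕ → ℕ → Step → ℕ
  Σ y m t = sum (map ((λ p → if isGMotzkinFrom y m p then w p else 0) ∘ (t ∷_)) L)
  by-first-step : ∀ y m → Σ y m U + (Σ y m D + (Σ y m H + (Σ y m V + 0))) ≡
                          firstSteps (λ t y' m' → pathSum (w ∘ (t ∷_)) k y' m') y m
  by-first-step zero zero =
    cong₂ _+_ (sum-map-zero L (λ p → if-∧-false (isZero? (walk 1 p)) _))
      (cong₂ _+_ (sum-map-zero L (λ _ → refl))
        (cong₂ _+_ (sum-map-zero L (λ p → if-∧-false (isZero? (walk 0 p)) _))
          (cong (_+ 0) (sum-map-zero L (λ _ → refl)))))
  by-first-step zero (suc m) = cong (Σ 0 (suc m) U +_) (trans
    (cong₂ _+_ (sum-map-zero L (λ _ → refl)) (cong (Σ 0 (suc m) H +_) (cong (_+ 0) (sum-map-zero L (λ _ → refl)))))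
    (+-identityʳ _))
  by-first-step (suc y) zero = trans
    (cong₂ _+_ (sum-map-zero L (λ p → if-∧-false (isZero? (walk (suc (suc y)) p)) _))
      (cong₂ _+_ (sum-map-zero L (λ p → if-∧-false (isZero? (walk y p)) _))
        (cong₂ _+_ (sum-map-zero L (λ p → if-∧-false (isZero? (walk (suc y) p)) _)) refl)))
    (+-identityʳ _)
  by-first-step (suc y) (suc m) =
    solve 4 (λ u d h v → u :+ (d :+ (h :+ (v :+ con 0))) := u :+ h :+ d :+ v) refl
      (Σ (suc y) (suc m) U) (Σ (suc y) (suc m) D) (Σ (suc y) (suc m) H) (Σ (suc y) (suc m) V)
    where open +-*-Solver

pathSum-const+ : ∀ a w k y m → pathSum (λ p → a + w p) k y m ≡ a * pathCount k y m + pathSum w k y m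
pathSum-const+ a w k y m = begin
  sum (map (λ p → if b p then a + w p else 0) L)
    ≡⟨ sum-map-cong L (λ p → split (b p)) ⟩
  sum (map (λ p → a * (if b p then 1 else 0) + (if b p then w p else 0)) L)
    ≡⟨ sum-map-+ _ _ L ⟩
  sum (map (λ p → a * (if b p then 1 else 0)) L) + pathSum w k y m
    ≡⟨ cong (_+ pathSum w k y m) (sum-map-*ˡ a _ L) ⟩
  a * pathCount k y m + pathSum w k y m
    ∎
  where
  open ≡-Reasoning
  L = allLists k
  b = isGMotzkinFrom y m
  split : ∀ {p} c → (if c then a + w p else 0) ≡ a * (if c then 1 else 0) + (if c then w p else 0)
  split true  = cong (_+ _) (sym (*-identityʳ a))
  split false = sym (trans (+-identityʳ (a * 0)) (*-zeroʳ a))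

pathCount-suc : ∀ k y m →
  pathCount (suc k) y m ≡ (if isGMotzkinFrom y m [] then 1 else 0) + firstSteps (λ _ → pathCount k) y m
pathCount-suc = pathSum-suc (λ _ → 1)

stepCount-suc : ∀ s i k y m → stepCount s i (suc k) y m ≡
  firstSteps (λ t y' m' → marks s i t y' * pathCount k y' m') y m + firstSteps (λ _ → stepCount s i k) y m
stepCount-suc s i k y m = begin
  stepCount s i (suc k) y m
    ≡⟨ pathSum-suc (countAt s i y) k y m ⟩
  (if isGMotzkinFrom y m [] then 0 else 0) + firstSteps (λ t y' m' → pathSum (countAt s i y ∘ (t ∷_)) k y' m') y m
    ≡⟨ cong₂ _+_ (if-const (isGMotzkinFrom y m [])) (firstSteps-cong y m by-first-step) ⟩
  firstSteps (λ t y' m' → marks s i t y' * pathCount k y' m' + stepCount s i k y' m') y m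
    ≡⟨ firstSteps-+ _ _ y m ⟩
  firstSteps (λ t y' m' → marks s i t y' * pathCount k y' m') y m + firstSteps (λ _ → stepCount s i k) y m
    ∎
  where
  open ≡-Reasoning
  if-const : ∀ c → (if c then 0 else 0) ≡ 0
  if-const true  = refl
  if-const false = refl
  -- In each case countAt s i y (t ∷ p) unfolds to marks s i t y' + countAt s i y' p.
  by-first-step : ∀ {t y' m'} → FirstStep y m t y' m' →
    pathSum (countAt s i y ∘ (t ∷_)) k y' m' ≡ marks s i t y' * pathCount k y' m' + stepCount s i k y' m'
  by-first-step {t} {y'} {m'} up   = pathSum-const+ (marks s i t y') (countAt s i y') k y' m'
  by-first-step {t} {y'} {m'} flat = pathSum-const+ (marks s i t y') (countAt s i y') k y' m'
  by-first-step {t} {y'} {m'} down = pathSum-const+ (marks s i t y') (countAt s i y') k y' m'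
  by-first-step {t} {y'} {m'} drop = pathSum-const+ (marks s i t y') (countAt s i y') k y' m'

-- Generating functions of paths between two heights

below : (ℕ → Series) → ℕ → Series
below F zero    = zeroˢ
below F (suc y) = F y

-- F y counts, by length, paths from height y; the empty path contributes s y, and the first step
-- is u, h or d (of length 1) or v (of length 0).
FirstStepEquations : (ℕ → Series) → (ℕ → Series) → Set
FirstStepEquations F s = ∀ y → F y ≗ ((s y ⊕ (X ⊛ ((F (suc y) ⊕ F y) ⊕ below F y))) ⊕ below F y)

FirstStepEquations-coefficients : ∀ {F s} → FirstStepEquations F s →
  ∀ y m → F y m ≡ s y m + firstSteps (λ _ y' m' → F y' m') y m
FirstStepEquations-coefficients {F} {s} eqs zero    zero    = trans (eqs 0 0) (+-identityʳ _)
FirstStepEquations-coefficients {F} {s} eqs zero    (suc m) = trans (eqs 0 (suc m))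
  (trans (+-identityʳ (s 0 (suc m) + (X ⊛ ((F 1 ⊕ F 0) ⊕ zeroˢ)) (suc m)))
    (cong (s 0 (suc m) +_) (trans (X-⊛-suc ((F 1 ⊕ F 0) ⊕ zeroˢ) m) (+-identityʳ (F 1 m + F 0 m)))))
FirstStepEquations-coefficients {F} {s} eqs (suc y) zero    =
  trans (eqs (suc y) 0) (cong (_+ F y 0) (+-identityʳ _))
FirstStepEquations-coefficients {F} {s} eqs (suc y) (suc m) = trans (eqs (suc y) (suc m))
  (trans (cong (λ x → s (suc y) (suc m) + x + F y (suc m)) (X-⊛-suc ((F (suc (suc y)) ⊕ F (suc y)) ⊕ F y) m))
         (+-assoc (s (suc y) (suc m)) _ _))

FirstStepEquations-⊛ : ∀ {F s} → FirstStepEquations F s → ∀ M →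
                       FirstStepEquations (λ y → F y ⊛ M) (λ y → s y ⊛ M)
FirstStepEquations-⊛ {F} {s} eqs M y = begin
  F y ⊛ M
    ≈⟨ ⊛-congʳ M (eqs y) ⟩
  ((s y ⊕ (X ⊛ ((F (suc y) ⊕ F y) ⊕ below F y))) ⊕ below F y) ⊛ M
    ≈⟨ solve 6 (λ s x f₊ f f₋ m → ((s :+ (x :* ((f₊ :+ f) :+ f₋))) :+ f₋) :* m
                                 := ((s :* m) :+ (x :* (((f₊ :* m) :+ (f :* m)) :+ (f₋ :* m)))) :+ (f₋ :* m))
         (λ _ → refl) (s y) X (F (suc y)) (F y) (below F y) M ⟩
  ((s y ⊛ M) ⊕ (X ⊛ (((F (suc y) ⊛ M) ⊕ (F y ⊛ M)) ⊕ (below F y ⊛ M)))) ⊕ (below F y ⊛ M)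
    ≈⟨ ⊕-cong (⊕-congˡ (s y ⊛ M) (⊛-congˡ X (⊕-congˡ ((F (suc y) ⊛ M) ⊕ (F y ⊛ M)) (below-⊛ y))))
              (below-⊛ y) ⟩
  ((s y ⊛ M) ⊕ (X ⊛ (((F (suc y) ⊛ M) ⊕ (F y ⊛ M)) ⊕ below (λ y → F y ⊛ M) y))) ⊕ below (λ y → F y ⊛ M) y
    ∎
  where
  open ≈-Reasoning
  open SeriesSolver
  below-⊛ : ∀ y → (below F y ⊛ M) ≗ below (λ y → F y ⊛ M) y
  below-⊛ zero    = ⊛-zeroˡ M
  below-⊛ (suc y) = λ _ → refl

G : Series
G = geom ⊛ K

descent : Series
descent = (one ⊕ X) ⊛ G

ascent : Series
ascent = X ⊛ G

geom-equation : geom ≗ (one ⊕ (X ⊛ geom))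
geom-equation zero    = refl
geom-equation (suc n) = sym (X-⊛-suc geom n)

G-equation : G ≗ ((one ⊕ (X ⊛ G)) ⊕ (X ⊛ ((one ⊕ X) ⊛ (G ⊛ G))))
G-equation = begin
  geom ⊛ K
    ≈⟨ ⊛-congʳ K geom-equation ⟩
  (one ⊕ (X ⊛ geom)) ⊛ K
    ≈⟨ solve 3 (λ x g k → (con 1 :+ x :* g) :* k := k :+ x :* (g :* k)) (λ _ → refl) X geom K ⟩
  K ⊕ (X ⊛ G)
    ≈⟨ ⊕-cong K-equation (λ _ → refl) ⟩
  (one ⊕ (hArg ⊛ (K ⊛ K))) ⊕ (X ⊛ G)
    ≈⟨ solve 3 (λ x g k → (con 1 :+ ((x :* (con 1 :+ x)) :* (g :* (g :* con 1))) :* (k :* k)) :+ x :* (g :* k)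
                          := (con 1 :+ x :* (g :* k)) :+ x :* ((con 1 :+ x) :* ((g :* k) :* (g :* k))))
         (λ _ → refl) X geom K ⟩
  (one ⊕ (X ⊛ G)) ⊕ (X ⊛ ((one ⊕ X) ⊛ (G ⊛ G)))
    ∎
  where
  open ≈-Reasoning
  open SeriesSolver

descent-equation : descent ≗ (((one ⊕ X) ⊕ (X ⊛ descent)) ⊕ (X ⊛ (descent ⊛ descent)))
descent-equation = begin
  (one ⊕ X) ⊛ G
    ≈⟨ ⊛-congˡ (one ⊕ X) G-equation ⟩
  (one ⊕ X) ⊛ ((one ⊕ (X ⊛ G)) ⊕ (X ⊛ ((one ⊕ X) ⊛ (G ⊛ G))))
    ≈⟨ solve 2 (λ x g → (con 1 :+ x) :* ((con 1 :+ x :* g) :+ x :* ((con 1 :+ x) :* (g :* g)))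
                      := ((con 1 :+ x) :+ x :* ((con 1 :+ x) :* g))
                         :+ x :* (((con 1 :+ x) :* g) :* ((con 1 :+ x) :* g)))
         (λ _ → refl) X G ⟩
  ((one ⊕ X) ⊕ (X ⊛ descent)) ⊕ (X ⊛ (descent ⊛ descent))
    ∎
  where
  open ≈-Reasoning
  open SeriesSolver

-- Paths from height a to height b that reach the axis: a first-passage descents, an excursion
-- on the axis, then b ascents each made of a u-step and a path that does not return below it.
touching : ℕ → ℕ → Series
touching a b = G ⊛ ((descent ^ˢ a) ⊛ (ascent ^ˢ b))

touching-descent : ∀ a b → touching (suc a) b ≗
  ((X ⊛ ((touching (suc (suc a)) b ⊕ touching (suc a) b) ⊕ touching a b)) ⊕ touching a b)
touching-descent a b = begin
  G ⊛ ((descent ⊛ P) ⊛ Q)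
    ≈⟨ solve 4 (λ g p P Q → g :* ((p :* P) :* Q) := (g :* (P :* Q)) :* p) (λ _ → refl) G descent P Q ⟩
  touching a b ⊛ descent
    ≈⟨ ⊛-congˡ (touching a b) descent-equation ⟩
  touching a b ⊛ (((one ⊕ X) ⊕ (X ⊛ descent)) ⊕ (X ⊛ (descent ⊛ descent)))
    ≈⟨ solve 5 (λ x g p P Q → (g :* (P :* Q)) :* (((con 1 :+ x) :+ x :* p) :+ x :* (p :* p))
                            := (x :* ((g :* ((p :* (p :* P)) :* Q) :+ g :* ((p :* P) :* Q)) :+ g :* (P :* Q)))
                               :+ g :* (P :* Q))
         (λ _ → refl) X G descent P Q ⟩
  (X ⊛ ((touching (suc (suc a)) b ⊕ touching (suc a) b) ⊕ touching a b)) ⊕ touching a b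
    ∎
  where
  open ≈-Reasoning
  open SeriesSolver
  P = descent ^ˢ a
  Q = ascent ^ˢ b

touching-ascent : ∀ b → touching 0 (suc b) ≗ (X ⊛ ((touching 1 (suc b) ⊕ touching 0 (suc b)) ⊕ touching 0 b))
touching-ascent b = begin
  G ⊛ (one ⊛ (ascent ⊛ Q))
    ≈⟨ solve 3 (λ x g Q → g :* (con 1 :* ((x :* g) :* Q)) := (x :* (g :* Q)) :* g) (λ _ → refl) X G Q ⟩
  (X ⊛ (G ⊛ Q)) ⊛ G
    ≈⟨ ⊛-congˡ (X ⊛ (G ⊛ Q)) G-equation ⟩
  (X ⊛ (G ⊛ Q)) ⊛ ((one ⊕ (X ⊛ G)) ⊕ (X ⊛ ((one ⊕ X) ⊛ (G ⊛ G))))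
    ≈⟨ solve 3 (λ x g Q → (x :* (g :* Q)) :* ((con 1 :+ x :* g) :+ x :* ((con 1 :+ x) :* (g :* g)))
                        := x :* ((g :* ((((con 1 :+ x) :* g) :* con 1) :* ((x :* g) :* Q))
                                  :+ g :* (con 1 :* ((x :* g) :* Q)))
                                 :+ g :* (con 1 :* Q)))
         (λ _ → refl) X G Q ⟩
  X ⊛ ((touching 1 (suc b) ⊕ touching 0 (suc b)) ⊕ touching 0 b)
    ∎
  where
  open ≈-Reasoning
  open SeriesSolver
  Q = ascent ^ˢ b

touching-origin : touching 0 0 ≗ (one ⊕ (X ⊛ (touching 1 0 ⊕ touching 0 0)))
touching-origin = begin
  G ⊛ (one ⊛ one)
    ≈⟨ solve 1 (λ g → g :* (con 1 :* con 1) := g) (λ _ → refl) G ⟩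
  G
    ≈⟨ G-equation ⟩
  (one ⊕ (X ⊛ G)) ⊕ (X ⊛ ((one ⊕ X) ⊛ (G ⊛ G)))
    ≈⟨ solve 2 (λ x g → (con 1 :+ x :* g) :+ x :* ((con 1 :+ x) :* (g :* g))
                      := con 1 :+ x :* (g :* ((((con 1 :+ x) :* g) :* con 1) :* con 1) :+ g :* (con 1 :* con 1)))
         (λ _ → refl) X G ⟩
  one ⊕ (X ⊛ (touching 1 0 ⊕ touching 0 0))
    ∎
  where
  open ≈-Reasoning
  open SeriesSolver

-- Paths from height y to height h, split at the lowest level j ≤ min(y, h) they reach:
-- W y h = Σ_j touching (y - j) (h - j).
W : ℕ → ℕ → Series
W zero    h       = touching 0 h
W (suc y) zero    = touching (suc y) 0
W (suc y) (suc h) = touching (suc y) (suc h) ⊕ W y h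

W-y0 : ∀ y → W y 0 ≡ touching y 0
W-y0 zero    = refl
W-y0 (suc y) = refl

W-suc : ∀ y h → W y (suc h) ≗ (touching y (suc h) ⊕ below (λ y → W y h) y)
W-suc zero    h n = sym (+-identityʳ _)
W-suc (suc y) h n = refl

δ : ℕ → ℕ → Series
δ y h = constant (if y ≡ᵇ h then 1 else 0)

W-equations : ∀ h → FirstStepEquations (λ y → W y h) (λ y → δ y h)
W-equations zero    zero    = begin
  touching 0 0
    ≈⟨ touching-origin ⟩
  one ⊕ (X ⊛ (touching 1 0 ⊕ touching 0 0))
    ≈⟨ solve 3 (λ x a b → con 1 :+ x :* (a :+ b) := (con 1 :+ x :* ((a :+ b) :+ con 0)) :+ con 0)
         (λ _ → refl) X (touching 1 0) (touching 0 0) ⟩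
  (one ⊕ (X ⊛ ((touching 1 0 ⊕ touching 0 0) ⊕ zeroˢ))) ⊕ zeroˢ
    ≈⟨ ⊕-cong (⊕-cong one≗constant (λ _ → refl)) (λ _ → refl) ⟩
  (δ 0 0 ⊕ (X ⊛ ((touching 1 0 ⊕ touching 0 0) ⊕ zeroˢ))) ⊕ zeroˢ
    ∎
  where
  open ≈-Reasoning
  open SeriesSolver
W-equations zero    (suc y) n rewrite W-y0 y = trans (touching-descent y 0 n)
  (cong (λ c → c + (X ⊛ ((touching (suc (suc y)) 0 ⊕ touching (suc y) 0) ⊕ touching y 0)) n + touching y 0 n)
        (sym (constant-0 n)))
W-equations (suc h) zero    = begin
  touching 0 (suc h)
    ≈⟨ touching-ascent h ⟩
  X ⊛ ((touching 1 (suc h) ⊕ touching 0 (suc h)) ⊕ touching 0 h)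
    ≈⟨ solve 4 (λ x a b c → x :* ((a :+ b) :+ c) := (con 0 :+ x :* (((a :+ c) :+ b) :+ con 0)) :+ con 0)
         (λ _ → refl) X (touching 1 (suc h)) (touching 0 (suc h)) (touching 0 h) ⟩
  (zeroˢ ⊕ (X ⊛ ((W 1 (suc h) ⊕ W 0 (suc h)) ⊕ zeroˢ))) ⊕ zeroˢ
    ≈⟨ ⊕-cong (⊕-cong (λ n → sym (constant-0 n)) (λ _ → refl)) (λ _ → refl) ⟩
  (δ 0 (suc h) ⊕ (X ⊛ ((W 1 (suc h) ⊕ W 0 (suc h)) ⊕ zeroˢ))) ⊕ zeroˢ
    ∎
  where
  open ≈-Reasoning
  open SeriesSolver
W-equations (suc h) (suc y) = begin
  t ⊕ w
    ≈⟨ ⊕-cong (touching-descent y (suc h)) (W-equations h y) ⟩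
  ((X ⊛ ((t₊ ⊕ t) ⊕ t₋)) ⊕ t₋) ⊕ ((δ y h ⊕ (X ⊛ ((w₊ ⊕ w) ⊕ w₋))) ⊕ w₋)
    ≈⟨ solve 8 (λ x a b c d w₊ w w₋ → ((x :* ((a :+ b) :+ c)) :+ c) :+ ((d :+ (x :* ((w₊ :+ w) :+ w₋))) :+ w₋)
                                     := (d :+ (x :* (((a :+ w₊) :+ (b :+ w)) :+ (c :+ w₋)))) :+ (c :+ w₋))
         (λ _ → refl) X t₊ t t₋ (δ y h) w₊ w w₋ ⟩
  (δ y h ⊕ (X ⊛ (((t₊ ⊕ w₊) ⊕ (t ⊕ w)) ⊕ (t₋ ⊕ w₋)))) ⊕ (t₋ ⊕ w₋)
    ≈⟨ ⊕-cong (⊕-congˡ (δ y h) (⊛-congˡ X (⊕-congˡ ((t₊ ⊕ w₊) ⊕ (t ⊕ w)) W-suc⁻)))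
              W-suc⁻ ⟩
  (δ (suc y) (suc h) ⊕ (X ⊛ ((W (suc (suc y)) (suc h) ⊕ W (suc y) (suc h)) ⊕ W y (suc h)))) ⊕ W y (suc h)
    ∎
  where
  open ≈-Reasoning
  open SeriesSolver
  t₊ = touching (suc (suc y)) (suc h)
  t = touching (suc y) (suc h)
  t₋ = touching y (suc h)
  w₊ = W (suc y) h
  w = W y h
  w₋ = below (λ y → W y h) y
  W-suc⁻ : (t₋ ⊕ w₋) ≗ W y (suc h)
  W-suc⁻ n = sym (W-suc y h n)

pathCount≡W : ∀ {k y m} → 2 * m + y ≤ k → pathCount k y m ≡ W y 0 m
pathCount≡W {k} {y} {m} = unique-solution pathCount (λ y m → W y 0 m) (λ y m → δ y 0 m)
  (FirstStepEquations-coefficients (W-equations 0)) refl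
  (λ k y m _ → trans (pathCount-suc k y m) (cong (_+ firstSteps (λ _ → pathCount k) y m) (empty-path y m)))
  k y m
  where
  empty-path : ∀ y m → (if isGMotzkinFrom y m [] then 1 else 0) ≡ δ y 0 m
  empty-path zero    zero    = refl
  empty-path zero    (suc m) = refl
  empty-path (suc y) m       = sym (constant-0 m)

marked-pathCount : ∀ {k} y i m → 2 * m + y ≤ k →
  (if y ≡ᵇ i then 1 else 0) * pathCount k y m ≡ (if y ≡ᵇ i then 1 else 0) * W i 0 m
marked-pathCount y i m fuel with y ≡ᵇ i in y≡ᵇi
... | true  = cong (1 *_) (trans (pathCount≡W fuel) (cong (λ x → W x 0 m) (≡ᵇ⇒≡ y i (subst Bool.T (sym y≡ᵇi) _))))
... | false = refl

-- Cutting a path at a marked step at level i leaves a path from its start to height i + 1, and the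
-- marked step followed by the rest of the path, counted by M.
stepCount≡ : ∀ s i M →
  (∀ k y m → 2 * m + y ≤ suc k →
     firstSteps (λ t y' m' → marks s i t y' * pathCount k y' m') y m ≡ (δ y (suc i) ⊛ M) m) →
  ∀ {k y m} → 2 * m + y ≤ k → stepCount s i k y m ≡ (W y (suc i) ⊛ M) m
stepCount≡ s i M marked-first-step {k} {y} {m} =
  unique-solution (stepCount s i) (λ y m → (W y (suc i) ⊛ M) m) (λ y m → (δ y (suc i) ⊛ M) m)
    (FirstStepEquations-coefficients (FirstStepEquations-⊛ (W-equations (suc i)) M)) refl
    (λ k y m fuel → trans (stepCount-suc s i k y m)
      (cong (_+ firstSteps (λ _ → stepCount s i k) y m) (marked-first-step k y m fuel)))
    k y m

vSteps≡ : ∀ i {k y m} → 2 * m + y ≤ k → stepCount V i k y m ≡ (W y (suc i) ⊛ W i 0) m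
vSteps≡ i = stepCount≡ V i (W i 0) marked-first-step
  where
  marked-first-step : ∀ k y m → 2 * m + y ≤ suc k →
    firstSteps (λ t y' m' → marks V i t y' * pathCount k y' m') y m ≡ (δ y (suc i) ⊛ W i 0) m
  marked-first-step k zero    zero    _    = refl
  marked-first-step k zero    (suc m) _    = sym (constant-⊛ 0 (W i 0) (suc m))
  marked-first-step k (suc y) m       fuel = trans (only-v m)
    (trans (marked-pathCount {k} y i m (fuel-step (drop {y} {m}) fuel))
           (sym (constant-⊛ (if y ≡ᵇ i then 1 else 0) (W i 0) m)))
    where
    only-v : ∀ m → firstSteps (λ t y' m' → marks V i t y' * pathCount k y' m') (suc y) m
                   ≡ marks V i V y * pathCount k y m
    only-v zero    = refl
    only-v (suc m) = refl

dSteps≡ : ∀ i {k y m} → 2 * m + y ≤ k → stepCount D i k y m ≡ (W y (suc i) ⊛ (X ⊛ W i 0)) m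
dSteps≡ i = stepCount≡ D i (X ⊛ W i 0) marked-first-step
  where
  marked-first-step : ∀ k y m → 2 * m + y ≤ suc k →
    firstSteps (λ t y' m' → marks D i t y' * pathCount k y' m') y m ≡ (δ y (suc i) ⊛ (X ⊛ W i 0)) m
  marked-first-step k zero    zero    _    = refl
  marked-first-step k zero    (suc m) _    = sym (constant-⊛ 0 (X ⊛ W i 0) (suc m))
  marked-first-step k (suc y) zero    _    =
    sym (trans (constant-⊛ (if y ≡ᵇ i then 1 else 0) (X ⊛ W i 0) 0) (*-zeroʳ (if y ≡ᵇ i then 1 else 0)))
  marked-first-step k (suc y) (suc m) fuel = begin
    marks D i D y * pathCount k y m + 0             ≡⟨ +-identityʳ _ ⟩
    marks D i D y * pathCount k y m                 ≡⟨ marked-pathCount {k} y i m (fuel-step (down {y} {m}) fuel) ⟩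
    marks D i D y * W i 0 m                         ≡⟨ cong (marks D i D y *_) (X-⊛-suc (W i 0) m) ⟨
    marks D i D y * (X ⊛ W i 0) (suc m)             ≡⟨ constant-⊛ (marks D i D y) (X ⊛ W i 0) (suc m) ⟨
    (δ (suc y) (suc i) ⊛ (X ⊛ W i 0)) (suc m)       ∎
    where open ≡-Reasoning

β≡ : ∀ n i → β n i ≡ (W 0 (suc i) ⊛ W i 0) (suc n)
β≡ n i = trans (sum-filterB (isGMotzkin (suc n)) (countAt V i 0) (allLists (2 * suc n)))
               (vSteps≡ i {2 * suc n} {0} {suc n} (≤-reflexive (+-identityʳ (2 * suc n))))

γ≡β : ∀ n i → γ n i ≡ β n i
γ≡β n i = begin
  γ n i
    ≡⟨ sum-filterB (isGMotzkin (suc (suc n))) (countAt D i 0) (allLists (2 * suc (suc n))) ⟩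
  stepCount D i (2 * suc (suc n)) 0 (suc (suc n))
    ≡⟨ dSteps≡ i {2 * suc (suc n)} {0} {suc (suc n)} (≤-reflexive (+-identityʳ (2 * suc (suc n)))) ⟩
  (W 0 (suc i) ⊛ (X ⊛ W i 0)) (suc (suc n))
    ≡⟨ SeriesSolver.solve 3 (λ a x b → a :* (x :* b) := x :* (a :* b)) (λ _ → refl) (W 0 (suc i)) X (W i 0) (suc (suc n)) ⟩
  (X ⊛ (W 0 (suc i) ⊛ W i 0)) (suc (suc n))
    ≡⟨ X-⊛-suc (W 0 (suc i) ⊛ W i 0) (suc n) ⟩
  (W 0 (suc i) ⊛ W i 0) (suc n)
    ≡⟨ β≡ n i ⟨
  β n i
    ∎
  where
  open ≡-Reasoning
  open SeriesSolver using (_:*_; _:=_)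

W-riordan : ∀ i → (W 0 (suc i) ⊛ W i 0) ≗ (X ⊛ (riordanD ⊛ (riordanH ^ˢ i)))
W-riordan i = begin
  W 0 (suc i) ⊛ W i 0
    ≡⟨ cong (W 0 (suc i) ⊛_) (W-y0 i) ⟩
  (G ⊛ (one ⊛ (ascent ⊛ (ascent ^ˢ i)))) ⊛ (G ⊛ ((descent ^ˢ i) ⊛ one))
    ≈⟨ ⊛-cong (⊛-congˡ G (⊛-congˡ one (⊛-congˡ ascent ascent^i))) (⊛-congˡ G (⊛-congʳ one descent^i)) ⟩
  (G ⊛ (one ⊛ (ascent ⊛ (Xⁱ ⊛ (geomⁱ ⊛ Kⁱ))))) ⊛ (G ⊛ ((Pⁱ ⊛ (geomⁱ ⊛ Kⁱ)) ⊛ one))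
    ≈⟨ solve 7 (λ x g k xⁱ pⁱ gⁱ kⁱ →
         ((g :* k) :* (con 1 :* ((x :* (g :* k)) :* (xⁱ :* (gⁱ :* kⁱ))))) :* ((g :* k) :* ((pⁱ :* (gⁱ :* kⁱ)) :* con 1))
         := x :* (((g :* (g :* (g :* con 1))) :* (k :* (k :* (k :* con 1))))
                  :* (((xⁱ :* pⁱ) :* (gⁱ :* (gⁱ :* con 1))) :* (kⁱ :* (kⁱ :* con 1)))))
         (λ _ → refl) X geom K Xⁱ Pⁱ geomⁱ Kⁱ ⟩
  X ⊛ (riordanD ⊛ (((Xⁱ ⊛ Pⁱ) ⊛ (geomⁱ ^ˢ 2)) ⊛ (Kⁱ ^ˢ 2)))
    ≈⟨ ⊛-congˡ X (⊛-congˡ riordanD (λ n → sym (riordanH^i n))) ⟩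
  X ⊛ (riordanD ⊛ (riordanH ^ˢ i))
    ∎
  where
  open ≈-Reasoning
  open SeriesSolver
  Xⁱ = X ^ˢ i
  Pⁱ = (one ⊕ X) ^ˢ i
  geomⁱ = geom ^ˢ i
  Kⁱ = K ^ˢ i
  Gⁱ : (G ^ˢ i) ≗ (geomⁱ ⊛ Kⁱ)
  Gⁱ = ^ˢ-⊛ geom K i
  ascent^i : (ascent ^ˢ i) ≗ (Xⁱ ⊛ (geomⁱ ⊛ Kⁱ))
  ascent^i n = trans (^ˢ-⊛ X G i n) (⊛-congˡ Xⁱ Gⁱ n)
  descent^i : (descent ^ˢ i) ≗ (Pⁱ ⊛ (geomⁱ ⊛ Kⁱ))
  descent^i n = trans (^ˢ-⊛ (one ⊕ X) G i n) (⊛-congˡ Pⁱ Gⁱ n)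
  riordanH^i : (riordanH ^ˢ i) ≗ (((Xⁱ ⊛ Pⁱ) ⊛ (geomⁱ ^ˢ 2)) ⊛ (Kⁱ ^ˢ 2))
  riordanH^i n = trans (^ˢ-⊛ hArg (K ^ˢ 2) i n) (⊛-cong
    (λ m → trans (^ˢ-⊛ (X ⊛ (one ⊕ X)) (geom ^ˢ 2) i m) (⊛-cong (^ˢ-⊛ X (one ⊕ X) i) (^ˢ-square-comm geom i) m))
    (^ˢ-square-comm K i) n)

β≡riordanEntry : ∀ n i → β n i ≡ riordanEntry riordanD riordanH n i
β≡riordanEntry n i = trans (β≡ n i) (trans (W-riordan i (suc n)) (X-⊛-suc (riordanD ⊛ (riordanH ^ˢ i)) n))

theorem3p5 : ∀ n i → i ≤ n →
    (β n i ≡ formula n i) × (γ n i ≡ formula n i) ×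
    (β n i ≡ riordanEntry riordanD riordanH n i)
theorem3p5 n i i≤n = β≡formula , trans (γ≡β n i) β≡formula , β≡riordanEntry n i
  where
  β≡formula : β n i ≡ formula n i
  β≡formula = trans (β≡riordanEntry n i) (riordanEntry≡formula n i i≤n)
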